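{- For every positive and abundant matrix $A\in\mathbb{Z}^{r\times m}$ and vector $\mathbf{b}\in\mathbb{Z}^r$ with $S(A,\mathbf{b})\neq\emptyset$, we have $d(\mathcal{S}_0(A,\mathbf{b},n)) = \Theta\left(n^{m-\mathrm{rk}(A)-1}\right)$ as $n\to\infty$.
   Context: $S(A,\mathbf{b}) = \{\mathbf{x}\in\mathbb{Z}^m: A\mathbf{x}^T=\mathbf{b}^T\}$; $S_0(A,\mathbf{b})$ is its subset of vectors with pairwise distinct entries; $\mathcal{S}_0(A,\mathbf{b},n)$ is the hypergraph on vertex set $[n]$ with edges $\{x_1,\dots,x_m\}$ for $(x_1,\dots,x_m)\in S_0(A,\mathbf{b})\cap[n]^m$. For a hypergraph $\mathcal{H}$, $d(\mathcal{H}) = e(\mathcal{H})/v(\mathcal{H})$ (number of edges over number of vertices). For $Q\subseteq[m]$, $A^Q$ is the submatrix of columns indexed by $Q$. $A$ is positive if $S(A,\mathbf{0})\cap\mathbb{N}^m\neq\emptyset$; $A$ is abundant if $\mathrm{rk}(A)>0$ and $\mathrm{rk}(A^Q)=\mathrm{rk}(A)$ for all $Q$ with $|Q|\geq m-2$. -}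

module Defs where

open import Data.Bool using (Bool; true; false; _∧_; _∨_; not)
open import Data.Bool.Properties using () renaming (_≟_ to _≟B_)
open import Data.Nat as ℕ using (ℕ; zero; suc; _∸_; _≡ᵇ_)
open import Data.Integer as ℤ using (ℤ; +_)
open import Data.Fin using (Fin; toℕ; zero; suc; _≟_)
open import Data.Fin.Subset using (Subset; ⊤; _∈_; _∉_; _⊆_; ∣_∣)
open import Data.List as List using (List; []; _∷_; allFin; concatMap; filterᵇ; deduplicate; length; upTo)
open import Data.Bool.ListAction using (all; any)
open import Data.Vec as Vec using (Vec; tabulate)
open import Data.Vec.Properties using (≡-dec)
open import Data.Vec.Functional as VF using () renaming (_∷_ to _∷ᶠ_)
open import Data.Rational as ℚ using (ℚ; 0ℚ; _/_)
open import Data.Product using (Σ; ∃; _×_)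
open import Relation.Nullary using (¬_; does)
open import Relation.Binary.PropositionalEquality using (_≡_; _≢_)

Matrix : ℕ → ℕ → Set
Matrix r m = Fin r → Fin m → ℤ

dot : ∀ {m} → (Fin m → ℤ) → (Fin m → ℤ) → ℤ
dot {zero}  u v = + 0
dot {suc m} u v = u zero ℤ.* v zero ℤ.+ dot (λ j → u (suc j)) (λ j → v (suc j))

mul : ∀ {r m} → Matrix r m → (Fin m → ℤ) → Fin r → ℤ
mul A x i = dot (A i) x

IsSolution : ∀ {r m} → Matrix r m → (Fin r → ℤ) → (Fin m → ℤ) → Set
IsSolution A b x = ∀ i → mul A x i ≡ b i

Positive : ∀ {r m} → Matrix r m → Set
Positive A = ∃ λ x → (∀ j → + 0 ℤ.< x j) × IsSolution A (λ _ → + 0) x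

-- the columns of A indexed by Q are linearly dependent (over ℚ, equivalently
-- with integer coefficients after clearing denominators)
ColumnsDependent : ∀ {r m} → Matrix r m → Subset m → Set
ColumnsDependent {m = m} A Q =
  ∃ λ (c : Fin m → ℤ) → (∀ j → j ∉ Q → c j ≡ + 0)
                      × (∃ λ j → c j ≢ + 0)
                      × IsSolution A (λ _ → + 0) c

ColumnsIndependent : ∀ {r m} → Matrix r m → Subset m → Set
ColumnsIndependent A Q = ¬ ColumnsDependent A Q

RankOn : ∀ {r m} → Matrix r m → Subset m → ℕ → Set
RankOn {m = m} A Q k =
  (∃ λ (Q' : Subset m) → Q' ⊆ Q × ∣ Q' ∣ ≡ k × ColumnsIndependent A Q')
  × (∀ (Q' : Subset m) → Q' ⊆ Q → ColumnsIndependent A Q' → ∣ Q' ∣ ℕ.≤ k)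

Rank : ∀ {r m} → Matrix r m → ℕ → Set
Rank {m = m} A k = RankOn A ⊤ k

Abundant : ∀ {r m} → Matrix r m → Set
Abundant {m = m} A =
  ∃ λ k → Rank A k × 0 ℕ.< k × (∀ (Q : Subset m) → m ∸ 2 ℕ.≤ ∣ Q ∣ → RankOn A Q k)

tuples : (m n : ℕ) → List (Fin m → ℕ)
tuples zero    n = (λ ()) ∷ []
tuples (suc m) n =
  concatMap (λ v → List.map (λ a → a ∷ᶠ v) (List.map suc (upTo n))) (tuples m n)

solᵇ : ∀ {r m} → Matrix r m → (Fin r → ℤ) → (Fin m → ℕ) → Bool
solᵇ {r} A b x = all (λ i → does (mul A (λ j → + (x j)) i ℤ.≟ b i)) (allFin r)

distinctᵇ : ∀ {m} → (Fin m → ℕ) → Bool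
distinctᵇ {m} x =
  all (λ i → all (λ j → does (i ≟ j) ∨ not (x i ≡ᵇ x j)) (allFin m)) (allFin m)

-- the edge {x_1, …, x_m} ⊆ [n], as a subset of Fin n (vertex v ↦ toℕ v + 1)
edgeOf : ∀ {m} (n : ℕ) → (Fin m → ℕ) → Subset n
edgeOf {m} n x = tabulate (λ v → any (λ j → suc (toℕ v) ≡ᵇ x j) (allFin m))

edges : ∀ {r m} → Matrix r m → (Fin r → ℤ) → (n : ℕ) → List (Subset n)
edges {m = m} A b n =
  deduplicate (≡-dec _≟B_)
    (List.map (edgeOf n) (filterᵇ (λ x → solᵇ A b x ∧ distinctᵇ x) (tuples m n)))

numEdges : ∀ {r m} → Matrix r m → (Fin r → ℤ) → ℕ → ℕ
numEdges A b n = length (edges A b n)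

-- d(𝓗) = e(𝓗) / v(𝓗), as a rational (0 for the empty vertex set)
ratio : ℕ → ℕ → ℚ
ratio e zero    = 0ℚ
ratio e (suc v) = + e / suc v

-- d(𝒮₀(A, b, n)); the vertex set is [n], so v = n
density : ∀ {r m} → Matrix r m → (Fin r → ℤ) → ℕ → ℚ
density A b n = ratio (numEdges A b n) n

ℕtoℚ : ℕ → ℚ
ℕtoℚ n = + n / 1

{-# OPTIONS --safe #-}
module Submission where

-- Let k = rk A and let Q be a maximal independent set of k columns. Two solutions that agree
-- outside Q agree everywhere, so [n]^m contains at most n^(m-k) solutions, and every edge of
-- 𝒮₀(A,b,n) comes from one of them.
-- Conversely, fix a solution x₀, a positive kernel vector y and, for each column j ∉ Q, a kernel
-- vector Cⱼ supported on Q ∪ {j} with Cⱼ j ≠ 0. The vectors x₀ + T·y + Σ_{j∉Q} sⱼ Cⱼ with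
-- 0 ≤ sⱼ < L and T of order L are distinct solutions in [n]^m once n ≥ (L+1)H, which gives
-- (n/4H)^(m-k) solutions for a suitable L. By abundance, the solutions with two equal entries
-- satisfy an extra independent equation and number O(n^(m-k-1)), and an edge comes from at most
-- m^m solutions; hence e(𝒮₀(A,b,n)) is also at least a constant times n^(m-k).

open import Defs

open import Data.Bool using (Bool; true; false; T; _∧_; _∨_; not; if_then_else_)
open import Data.Bool.Properties using (T-≡; T-∧; T-not-≡; ∧-identityʳ; ∧-zeroʳ) renaming (_≟_ to _≟B_)
open import Data.Bool.ListAction using (all; any)
open import Data.Empty using (⊥-elim)
open import Data.Fin using (Fin; zero; suc; _≟_; toℕ; fromℕ<)
open import Data.Fin.Properties using (toℕ-fromℕ<)
open import Data.Fin.Subset using (Subset; inside; outside; ∁; _∪_; ⁅_⁆) renaming (_∈_ to _∈ˢ_; _∉_ to _∉ˢ_)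
open import Data.Fin.Subset.Properties using (drop-there)
open import Data.List as List using (List; []; _∷_; _++_; upTo; concatMap; filterᵇ; length; allFin)
open import Data.List.Properties using (length-map; length-upTo)
open import Data.List.Membership.Propositional using (find; lose) renaming (_∈_ to _∈ᴸ_)
open import Data.List.Membership.Propositional.Properties
  using (∈-allFin; ∈-concatMap⁻; ∈-map⁺; ∈-map⁻; ∈-upTo⁺; ∈-upTo⁻; ∈-filter⁻; ∈-deduplicate⁺; ∈-deduplicate⁻)
import Data.List.Relation.Unary.All as All
open import Data.List.Relation.Unary.All.Properties using (all⁺; all⁻; ¬All⇒Any¬)
open import Data.List.Relation.Unary.Any using (here; there)
open import Data.List.Relation.Unary.Any.Properties using (any⁺; any⁻)
open import Data.List.Relation.Unary.AllPairs using (_∷_)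
open import Data.List.Relation.Unary.Unique.Propositional using (Unique)
open import Data.List.Relation.Unary.Unique.Propositional.Properties using (upTo⁺; map⁺)
open import Data.Nat using (ℕ; zero; suc)
open import Data.Product using (∃; _×_; _,_; proj₁; proj₂)
open import Data.Vec using ([]; _∷_; here; there)
open import Data.Vec.Functional using () renaming (_∷_ to _∷ᶠ_)
open import Function using (_∘_; Equivalence)
open import Relation.Binary.PropositionalEquality
open import Relation.Nullary using (¬_; Dec; yes; no; does)
open import Relation.Nullary.Decidable using (T?; dec-true; dec-false)

T-does⁻ : ∀ {P : Set} (P? : Dec P) → T (does P?) → P
T-does⁻ (yes p) _ = p

T-does⁺ : ∀ {P : Set} (P? : Dec P) → P → T (does P?)
T-does⁺ P? p = Equivalence.from T-≡ (dec-true P? p)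

module Counting where

  open import Data.Nat using (_+_; _*_; _∸_; _^_; _≤_; _<_; z≤n; s≤s; _≡ᵇ_)
  open import Data.Nat.Properties
  import Data.Nat.Tactic.RingSolver as ℕ-Solver
  open import Data.Fin.Subset using (∣_∣)

  private
    variable
      X Y : Set

  indicator : Bool → ℕ
  indicator true  = 1
  indicator false = 0

  sumBy : (X → ℕ) → List X → ℕ
  sumBy f []       = 0
  sumBy f (x ∷ xs) = f x + sumBy f xs

  count : (X → Bool) → List X → ℕ
  count p = sumBy (indicator ∘ p)

  indicator≤1 : ∀ b → indicator b ≤ 1
  indicator≤1 true  = s≤s z≤n
  indicator≤1 false = z≤n

  sumBy-cong : ∀ {f g : X → ℕ} xs → (∀ x → f x ≡ g x) → sumBy f xs ≡ sumBy g xs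
  sumBy-cong []       f≗g = refl
  sumBy-cong (x ∷ xs) f≗g = cong₂ _+_ (f≗g x) (sumBy-cong xs f≗g)

  sumBy-++ : ∀ (f : X → ℕ) xs ys → sumBy f (xs ++ ys) ≡ sumBy f xs + sumBy f ys
  sumBy-++ f []       ys = refl
  sumBy-++ f (x ∷ xs) ys = trans (cong (f x +_) (sumBy-++ f xs ys)) (sym (+-assoc (f x) _ _))

  sumBy-map : ∀ (f : Y → ℕ) (g : X → Y) xs → sumBy f (List.map g xs) ≡ sumBy (f ∘ g) xs
  sumBy-map f g []       = refl
  sumBy-map f g (x ∷ xs) = cong (f (g x) +_) (sumBy-map f g xs)

  sumBy-concatMap : ∀ (f : Y → ℕ) (g : X → List Y) xs
    → sumBy f (concatMap g xs) ≡ sumBy (λ x → sumBy f (g x)) xs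
  sumBy-concatMap f g []       = refl
  sumBy-concatMap f g (x ∷ xs) =
    trans (sumBy-++ f (g x) (concatMap g xs)) (cong (sumBy f (g x) +_) (sumBy-concatMap f g xs))

  sumBy-+ : ∀ (f g : X → ℕ) xs → sumBy (λ x → f x + g x) xs ≡ sumBy f xs + sumBy g xs
  sumBy-+ f g []       = refl
  sumBy-+ f g (x ∷ xs) = trans (cong (f x + g x +_) (sumBy-+ f g xs)) (interchange (f x) (g x) _ _)
    where
    interchange : ∀ a b c d → a + b + (c + d) ≡ a + c + (b + d)
    interchange = ℕ-Solver.solve-∀

  sumBy-const : ∀ c (xs : List X) → sumBy (λ _ → c) xs ≡ length xs * c
  sumBy-const c []       = refl
  sumBy-const c (x ∷ xs) = cong (c +_) (sumBy-const c xs)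

  sumBy-*ˡ : ∀ c (f : X → ℕ) xs → sumBy (λ x → c * f x) xs ≡ c * sumBy f xs
  sumBy-*ˡ c f []       = sym (*-zeroʳ c)
  sumBy-*ˡ c f (x ∷ xs) =
    trans (cong (c * f x +_) (sumBy-*ˡ c f xs)) (sym (*-distribˡ-+ c (f x) (sumBy f xs)))

  sumBy-*ʳ : ∀ c (f : X → ℕ) xs → sumBy (λ x → f x * c) xs ≡ sumBy f xs * c
  sumBy-*ʳ c f xs =
    trans (sumBy-cong xs (λ x → *-comm (f x) c)) (trans (sumBy-*ˡ c f xs) (*-comm c (sumBy f xs)))

  sumBy-swap : ∀ (g : X → Y → ℕ) xs ys
    → sumBy (λ x → sumBy (g x) ys) xs ≡ sumBy (λ y → sumBy (λ x → g x y) xs) ys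
  sumBy-swap g []       ys = sym (trans (sumBy-const 0 ys) (*-zeroʳ (length ys)))
  sumBy-swap g (x ∷ xs) ys =
    trans (cong (sumBy (g x) ys +_) (sumBy-swap g xs ys))
          (sym (sumBy-+ (g x) (λ y → sumBy (λ x → g x y) xs) ys))

  sumBy-mono : ∀ (f g : X → ℕ) xs → (∀ {x} → x ∈ᴸ xs → f x ≤ g x) → sumBy f xs ≤ sumBy g xs
  sumBy-mono f g []       f≤g = z≤n
  sumBy-mono f g (x ∷ xs) f≤g = +-mono-≤ (f≤g (here refl)) (sumBy-mono f g xs (f≤g ∘ there))

  ≤-sumBy : ∀ (f : X → ℕ) {xs x} → x ∈ᴸ xs → f x ≤ sumBy f xs
  ≤-sumBy f {x ∷ xs} (here refl) = m≤m+n (f x) _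
  ≤-sumBy f {y ∷ xs} (there x∈)  = ≤-trans (≤-sumBy f x∈) (m≤n+m _ (f y))

  length-filterᵇ : ∀ (p : X → Bool) xs → length (filterᵇ p xs) ≡ count p xs
  length-filterᵇ p []       = refl
  length-filterᵇ p (x ∷ xs) with p x
  ... | true  = cong suc (length-filterᵇ p xs)
  ... | false = length-filterᵇ p xs

  count-true : ∀ (xs : List X) → count (λ _ → true) xs ≡ length xs
  count-true []       = refl
  count-true (x ∷ xs) = cong suc (count-true xs)

  count-mono : ∀ (p q : X → Bool) xs → (∀ {x} → x ∈ᴸ xs → T (p x) → T (q x)) → count p xs ≤ count q xs
  count-mono p q xs p⇒q = sumBy-mono _ _ xs step
    where
    step : ∀ {x} → x ∈ᴸ xs → indicator (p x) ≤ indicator (q x)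
    step {x} x∈ with p x | q x | p⇒q x∈
    ... | false | _    | _  = z≤n
    ... | true  | true | _  = ≤-refl
    ... | true  | false | f = ⊥-elim (f _)

  count-∧≤ : ∀ (p q : X → Bool) xs → count (λ x → p x ∧ q x) xs ≤ count p xs
  count-∧≤ p q xs = count-mono _ p xs (λ _ → proj₁ ∘ Equivalence.to T-∧)

  count-zero : ∀ (p : X → Bool) xs → (∀ {x} → x ∈ᴸ xs → ¬ T (p x)) → count p xs ≡ 0
  count-zero p []       ¬p = refl
  count-zero p (x ∷ xs) ¬p with p x | ¬p (here refl)
  ... | false | _   = count-zero p xs (¬p ∘ there)
  ... | true  | ¬px = ⊥-elim (¬px _)

  count-split : ∀ (p q : X → Bool) xs
    → count p xs ≡ count (λ x → p x ∧ q x) xs + count (λ x → p x ∧ not (q x)) xs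
  count-split p q []       = refl
  count-split p q (x ∷ xs) with p x | q x
  ... | true  | true  = cong suc (count-split p q xs)
  ... | true  | false = trans (cong suc (count-split p q xs)) (sym (+-suc _ _))
  ... | false | _     = count-split p q xs

  count-∨ : ∀ (p q : X → Bool) xs
    → count (λ x → p x ∨ q x) xs ≡ count q xs + count (λ x → p x ∧ not (q x)) xs
  count-∨ p q []       = refl
  count-∨ p q (x ∷ xs) with p x | q x
  ... | true  | true  = cong suc (count-∨ p q xs)
  ... | true  | false = trans (cong suc (count-∨ p q xs)) (sym (+-suc _ _))
  ... | false | true  = cong suc (count-∨ p q xs)
  ... | false | false = count-∨ p q xs

  count-∨≤ : ∀ (p q : X → Bool) xs → count (λ x → p x ∨ q x) xs ≤ count p xs + count q xs
  count-∨≤ p q xs = begin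
    count (λ x → p x ∨ q x) xs                   ≡⟨ count-∨ p q xs ⟩
    count q xs + count (λ x → p x ∧ not (q x)) xs ≤⟨ +-monoʳ-≤ (count q xs) (count-∧≤ p _ xs) ⟩
    count q xs + count p xs                       ≡⟨ +-comm (count q xs) (count p xs) ⟩
    count p xs + count q xs                       ∎
    where open ≤-Reasoning

  count-∧-const : ∀ (p : X → Bool) c xs → count (λ x → p x ∧ c) xs ≡ indicator c * count p xs
  count-∧-const p true  xs = trans (sumBy-cong xs (λ x → cong indicator (∧-identityʳ (p x)))) (sym (+-identityʳ _))
  count-∧-const p false xs = count-zero _ xs (λ {x} _ → subst T (∧-zeroʳ (p x)))

  count-filterᵇ≤ : ∀ (p q : X → Bool) xs → count q (filterᵇ p xs) ≤ count q xs
  count-filterᵇ≤ p q []       = z≤n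
  count-filterᵇ≤ p q (x ∷ xs) with p x
  ... | true  = +-monoʳ-≤ (indicator (q x)) (count-filterᵇ≤ p q xs)
  ... | false = ≤-trans (count-filterᵇ≤ p q xs) (m≤n+m _ _)

  indicator-any≤count : ∀ (p : X → Bool) xs → indicator (any p xs) ≤ count p xs
  indicator-any≤count p []       = z≤n
  indicator-any≤count p (x ∷ xs) with p x
  ... | true  = s≤s z≤n
  ... | false = indicator-any≤count p xs

  count≤indicator-any : ∀ (p : X → Bool) xs → Unique xs
    → (∀ x x' → T (p x) → T (p x') → x ≡ x') → count p xs ≤ indicator (any p xs)
  count≤indicator-any p []       _            _    = z≤n
  count≤indicator-any p (x ∷ xs) (x∉xs ∷ uniq) p-at-most-one with p x in px
  ... | false = count≤indicator-any p xs uniq p-at-most-one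
  ... | true  = ≤-reflexive (cong suc (count-zero p xs notP))
    where
    notP : ∀ {y} → y ∈ᴸ xs → ¬ T (p y)
    notP y∈ py = All.lookup x∉xs y∈ (p-at-most-one _ _ (subst T (sym px) _) py)

  count-cover : ∀ (p : X → Bool) (q : Y → X → Bool) xs ys
    → (∀ {x} → x ∈ᴸ xs → T (p x) → ∃ λ y → y ∈ᴸ ys × T (q y x))
    → count p xs ≤ sumBy (λ y → count (q y) xs) ys
  count-cover p q xs ys covered =
    ≤-trans (sumBy-mono _ _ xs step) (≤-reflexive (sumBy-swap (λ x y → indicator (q y x)) xs ys))
    where
    step : ∀ {x} → x ∈ᴸ xs → indicator (p x) ≤ sumBy (λ y → indicator (q y x)) ys
    step {x} x∈ with p x | covered {x} x∈
    ... | false | _ = z≤n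
    ... | true  | cover with cover _
    ...   | y , y∈ , qyx = ≤-trans (≤-reflexive (cong indicator (sym (Equivalence.to T-≡ qyx)))) (≤-sumBy _ y∈)

  inImage : (Y → ℕ) → List Y → ℕ → Bool
  inImage g ss a = any (λ s → a ≡ᵇ g s) ss

  count-inImage≤length : ∀ (g : Y → ℕ) ss (as : List ℕ) → Unique as → count (inImage g ss) as ≤ length ss
  count-inImage≤length g []       as uniq = ≤-reflexive (count-zero _ as (λ _ ()))
  count-inImage≤length g (s ∷ ss) as uniq = begin
    count (inImage g (s ∷ ss)) as                     ≤⟨ count-∨≤ (λ a → a ≡ᵇ g s) (inImage g ss) as ⟩
    count (λ a → a ≡ᵇ g s) as + count (inImage g ss) as ≤⟨ +-mono-≤ at-most-one (count-inImage≤length g ss as uniq) ⟩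
    suc (length ss)                                   ∎
    where
    open ≤-Reasoning
    at-most-one : count (λ a → a ≡ᵇ g s) as ≤ 1
    at-most-one = ≤-trans (count≤indicator-any _ as uniq (λ a a' a≡ a'≡ → trans (≡ᵇ⇒≡ a _ a≡) (sym (≡ᵇ⇒≡ a' _ a'≡))))
                          (indicator≤1 _)

  length≤count-inImage : ∀ (g : Y → ℕ) ss (as : List ℕ) → Unique ss
    → (∀ {s s'} → s ∈ᴸ ss → s' ∈ᴸ ss → g s ≡ g s' → s ≡ s')
    → (∀ {s} → s ∈ᴸ ss → g s ∈ᴸ as)
    → length ss ≤ count (inImage g ss) as
  length≤count-inImage g []       as _             _     _    = z≤n
  length≤count-inImage g (s ∷ ss) as (s∉ss ∷ uniq) g-inj g-into = begin
    suc (length ss)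
      ≡⟨ +-comm 1 (length ss) ⟩
    length ss + 1
      ≤⟨ +-mono-≤ rest new ⟩
    count (inImage g ss) as + count (λ a → (a ≡ᵇ g s) ∧ not (inImage g ss a)) as
      ≡⟨ count-∨ (λ a → a ≡ᵇ g s) (inImage g ss) as ⟨
    count (inImage g (s ∷ ss)) as                             ∎
    where
    open ≤-Reasoning
    rest : length ss ≤ count (inImage g ss) as
    rest = length≤count-inImage g ss as uniq (λ s∈ s'∈ → g-inj (there s∈) (there s'∈)) (g-into ∘ there)
    gs∉image : ¬ T (inImage g ss (g s))
    gs∉image gs∈ with find (any⁻ _ ss gs∈)
    ... | s' , s'∈ , gs≡gs' = All.lookup s∉ss s'∈ (g-inj (here refl) (there s'∈) (≡ᵇ⇒≡ _ _ gs≡gs'))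
    new : 1 ≤ count (λ a → (a ≡ᵇ g s) ∧ not (inImage g ss a)) as
    new = ≤-trans (≤-reflexive (cong indicator (sym (Equivalence.to T-≡ gs-new))))
                  (indicator-any≤count _ as)
      where
      gs-new : T (any (λ a → (a ≡ᵇ g s) ∧ not (inImage g ss a)) as)
      gs-new = any⁺ _ (lose (g-into (here refl))
                 (Equivalence.from T-∧ (≡⇒≡ᵇ (g s) (g s) refl , Equivalence.from T-not-≡ (dec-false (T? _) gs∉image))))

  range : ℕ → List ℕ
  range n = List.map suc (upTo n)

  ∈-range⁺ : ∀ {n a} → 1 ≤ a → a ≤ n → a ∈ᴸ range n
  ∈-range⁺ {a = suc a} (s≤s z≤n) a≤n = ∈-map⁺ suc (∈-upTo⁺ a≤n)

  ∈-range⁻ : ∀ {n a} → a ∈ᴸ range n → 1 ≤ a × a ≤ n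
  ∈-range⁻ a∈ with ∈-map⁻ suc a∈
  ... | i , i∈ , refl = s≤s z≤n , ∈-upTo⁻ i∈

  length-range : ∀ n → length (range n) ≡ n
  length-range n = trans (length-map suc (upTo n)) (length-upTo n)

  range-unique : ∀ n → Unique (range n)
  range-unique n = map⁺ suc-injective (upTo⁺ n)

  InRange : ∀ {m} → ℕ → (Fin m → ℕ) → Set
  InRange n x = ∀ l → x l ∈ᴸ range n

  ∈-tuples⁻ : ∀ m n {x} → x ∈ᴸ tuples m n → InRange n x
  ∈-tuples⁻ (suc m) n x∈ l with find (∈-concatMap⁻ (λ v → List.map (_∷ᶠ v) (range n)) {xs = tuples m n} x∈)
  ... | v , v∈ , x∈′ with ∈-map⁻ (_∷ᶠ v) x∈′
  ... | a , a∈ , refl with l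
  ...   | zero   = a∈
  ...   | suc l′ = ∈-tuples⁻ m n v∈ l′

  count-tuples-suc : ∀ m n (P : (Fin (suc m) → ℕ) → Bool)
    → count P (tuples (suc m) n) ≡ sumBy (λ v → count (λ a → P (a ∷ᶠ v)) (range n)) (tuples m n)
  count-tuples-suc m n P =
    trans (sumBy-concatMap (indicator ∘ P) (λ v → List.map (_∷ᶠ v) (range n)) (tuples m n))
          (sumBy-cong (tuples m n) (λ v → sumBy-map (indicator ∘ P) (_∷ᶠ v) (range n)))

  AgreeOutside : ∀ {m} → Subset m → (Fin m → ℕ) → (Fin m → ℕ) → Set
  AgreeOutside R x x′ = ∀ l → l ∉ˢ R → x l ≡ x′ l

  DeterminedOutside : ∀ {m} → Subset m → ((Fin m → ℕ) → Bool) → Set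
  DeterminedOutside R P = ∀ x x′ → T (P x) → T (P x′) → AgreeOutside R x x′ → ∀ l → x l ≡ x′ l

  count-tuples≤ : ∀ m n (R : Subset m) (P : (Fin m → ℕ) → Bool)
    → DeterminedOutside R P → count P (tuples m n) ≤ n ^ ∣ ∁ R ∣
  count-tuples≤ zero n [] P _ = ≤-trans (≤-reflexive (+-identityʳ _)) (indicator≤1 (P _))
  count-tuples≤ (suc m) n (inside ∷ R) P det = begin
    count P (tuples (suc m) n)
      ≡⟨ count-tuples-suc m n P ⟩
    sumBy (λ v → count (λ a → P (a ∷ᶠ v)) (range n)) (tuples m n)
      ≤⟨ sumBy-mono _ _ (tuples m n) (λ _ → head-determined) ⟩
    count P′ (tuples m n)
      ≤⟨ count-tuples≤ m n R P′ det′ ⟩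
    n ^ ∣ ∁ R ∣                                                  ∎
    where
    open ≤-Reasoning
    P′ : (Fin m → ℕ) → Bool
    P′ v = any (λ a → P (a ∷ᶠ v)) (range n)
    head-determined : ∀ {v} → count (λ a → P (a ∷ᶠ v)) (range n) ≤ indicator (P′ v)
    head-determined = count≤indicator-any _ (range n) (range-unique n)
      (λ a a′ Pa Pa′ → det (a ∷ᶠ _) (a′ ∷ᶠ _) Pa Pa′ (λ { zero l∉ → ⊥-elim (l∉ here) ; (suc l) _ → refl }) zero)
    det′ : DeterminedOutside R P′
    det′ v v′ P′v P′v′ agree l with find (any⁻ _ (range n) P′v) | find (any⁻ _ (range n) P′v′)
    ... | a , _ , Pav | a′ , _ , Pav′ = det (a ∷ᶠ v) (a′ ∷ᶠ v′) Pav Pav′ agree′ (suc l)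
      where
      agree′ : AgreeOutside (inside ∷ R) (a ∷ᶠ v) (a′ ∷ᶠ v′)
      agree′ zero    l∉ = ⊥-elim (l∉ here)
      agree′ (suc l) l∉ = agree l (l∉ ∘ there)
  count-tuples≤ (suc m) n (outside ∷ R) P det = begin
    count P (tuples (suc m) n)
      ≡⟨ count-tuples-suc m n P ⟩
    sumBy (λ v → count (λ a → P (a ∷ᶠ v)) (range n)) (tuples m n)
      ≡⟨ sumBy-swap (λ v a → indicator (P (a ∷ᶠ v))) (tuples m n) (range n) ⟩
    sumBy (λ a → count (λ v → P (a ∷ᶠ v)) (tuples m n)) (range n)
      ≤⟨ sumBy-mono _ _ (range n) (λ {a} _ → count-tuples≤ m n R (λ v → P (a ∷ᶠ v)) (det′ a)) ⟩
    sumBy (λ _ → n ^ ∣ ∁ R ∣) (range n)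
      ≡⟨ sumBy-const _ (range n) ⟩
    length (range n) * n ^ ∣ ∁ R ∣
      ≡⟨ cong (_* n ^ ∣ ∁ R ∣) (length-range n) ⟩
    n ^ suc ∣ ∁ R ∣                                                 ∎
    where
    open ≤-Reasoning
    det′ : ∀ a → DeterminedOutside R (λ v → P (a ∷ᶠ v))
    det′ a v v′ Pv Pv′ agree l = det (a ∷ᶠ v) (a ∷ᶠ v′) Pv Pv′ agree′ (suc l)
      where
      agree′ : AgreeOutside (outside ∷ R) (a ∷ᶠ v) (a ∷ᶠ v′)
      agree′ zero    _  = refl
      agree′ (suc l) l∉ = agree l (l∉ ∘ there)

  Extendable : ∀ {m} → ℕ → Subset m → (Fin m → ℕ → Bool) → ((Fin m → ℕ) → Bool) → Set
  Extendable n R w P =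
    ∀ x → (∀ l → l ∉ˢ R → T (w l (x l))) → ∃ λ x′ → InRange n x′ × T (P x′) × AgreeOutside R x′ x

  count-tuples≥ : ∀ m n L (R : Subset m) (P : (Fin m → ℕ) → Bool) (w : Fin m → ℕ → Bool)
    → (∀ x x′ → (∀ l → x l ≡ x′ l) → T (P x) → T (P x′))
    → (∀ l → l ∉ˢ R → L ≤ count (w l) (range n))
    → Extendable n R w P
    → L ^ ∣ ∁ R ∣ ≤ count P (tuples m n)
  count-tuples≥ zero n L [] P w P-resp _ ext with ext (λ ()) (λ ())
  ... | x′ , _ , Px′ , _ = ≤-trans (≤-reflexive (cong indicator (sym (Equivalence.to T-≡ Px)))) (m≤m+n _ 0)
    where
    Px : T (P _)
    Px = P-resp x′ _ (λ ()) Px′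
  count-tuples≥ (suc m) n L (inside ∷ R) P w P-resp wide ext = begin
    L ^ ∣ ∁ R ∣
      ≤⟨ count-tuples≥ m n L R P′ (w ∘ suc) P′-resp (λ l l∉ → wide (suc l) (l∉ ∘ drop-there)) ext′ ⟩
    count P′ (tuples m n)
      ≤⟨ sumBy-mono _ _ (tuples m n) (λ _ → indicator-any≤count _ (range n)) ⟩
    sumBy (λ v → count (λ a → P (a ∷ᶠ v)) (range n)) (tuples m n)
      ≡⟨ count-tuples-suc m n P ⟨
    count P (tuples (suc m) n)                                     ∎
    where
    open ≤-Reasoning
    P′ : (Fin m → ℕ) → Bool
    P′ v = any (λ a → P (a ∷ᶠ v)) (range n)
    P′-resp : ∀ v v′ → (∀ l → v l ≡ v′ l) → T (P′ v) → T (P′ v′)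
    P′-resp v v′ v≗v′ P′v with find (any⁻ _ (range n) P′v)
    ... | a , a∈ , Pav = any⁺ _ (lose a∈ (P-resp _ _ (λ { zero → refl ; (suc l) → v≗v′ l }) Pav))
    ext′ : Extendable n R (w ∘ suc) P′
    ext′ v wv with ext (0 ∷ᶠ v) (λ { zero l∉ → ⊥-elim (l∉ here) ; (suc l) l∉ → wv l (l∉ ∘ there) })
    ... | x′ , x′∈ , Px′ , agree =
      x′ ∘ suc , x′∈ ∘ suc ,
      any⁺ _ (lose (x′∈ zero) (P-resp x′ _ (λ { zero → refl ; (suc l) → refl }) Px′)) ,
      λ l l∉ → agree (suc l) (l∉ ∘ drop-there)
  count-tuples≥ (suc m) n L (outside ∷ R) P w P-resp wide ext = begin
    L * L ^ ∣ ∁ R ∣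
      ≤⟨ *-monoˡ-≤ _ (wide zero (λ ())) ⟩
    count (w zero) (range n) * L ^ ∣ ∁ R ∣
      ≡⟨ sumBy-*ʳ _ (indicator ∘ w zero) (range n) ⟨
    sumBy (λ a → indicator (w zero a) * L ^ ∣ ∁ R ∣) (range n)
      ≤⟨ sumBy-mono _ _ (range n) (λ {a} _ → fibre a) ⟩
    sumBy (λ a → count (λ v → P (a ∷ᶠ v)) (tuples m n)) (range n)
      ≡⟨ sumBy-swap (λ v a → indicator (P (a ∷ᶠ v))) (tuples m n) (range n) ⟨
    sumBy (λ v → count (λ a → P (a ∷ᶠ v)) (range n)) (tuples m n)
      ≡⟨ count-tuples-suc m n P ⟨
    count P (tuples (suc m) n)                                      ∎
    where
    open ≤-Reasoning
    fibre : ∀ a → indicator (w zero a) * L ^ ∣ ∁ R ∣ ≤ count (λ v → P (a ∷ᶠ v)) (tuples m n)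
    fibre a with w zero a in wa
    ... | false = z≤n
    ... | true  = ≤-trans (≤-reflexive (+-identityʳ _))
        (count-tuples≥ m n L R (λ v → P (a ∷ᶠ v)) (w ∘ suc)
          (λ v v′ v≗v′ → P-resp _ _ (λ { zero → refl ; (suc l) → v≗v′ l }))
          (λ l l∉ → wide (suc l) (l∉ ∘ drop-there)) ext′)
      where
      ext′ : Extendable n R (w ∘ suc) (λ v → P (a ∷ᶠ v))
      ext′ v wv with ext (a ∷ᶠ v) (λ { zero _ → Equivalence.from T-≡ wa ; (suc l) l∉ → wv l (l∉ ∘ there) })
      ... | x′ , x′∈ , Px′ , agree =
        x′ ∘ suc , x′∈ ∘ suc ,
        P-resp x′ _ (λ { zero → agree zero (λ ()) ; (suc l) → refl }) Px′ ,
        λ l l∉ → agree (suc l) (l∉ ∘ drop-there)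

  allEntries : ∀ {m} → (ℕ → Bool) → (Fin m → ℕ) → Bool
  allEntries {zero}  w x = true
  allEntries {suc m} w x = w (x zero) ∧ allEntries w (x ∘ suc)

  allEntries⁺ : ∀ {m} (w : ℕ → Bool) (x : Fin m → ℕ) → (∀ l → T (w (x l))) → T (allEntries w x)
  allEntries⁺ {zero}  w x wx = _
  allEntries⁺ {suc m} w x wx = Equivalence.from T-∧ (wx zero , allEntries⁺ w (x ∘ suc) (wx ∘ suc))

  count-tuples-allEntries : ∀ m n (w : ℕ → Bool) → count (allEntries w) (tuples m n) ≡ count w (range n) ^ m
  count-tuples-allEntries zero    n w = refl
  count-tuples-allEntries (suc m) n w = begin
    count (allEntries w) (tuples (suc m) n)
      ≡⟨ count-tuples-suc m n (allEntries w) ⟩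
    sumBy (λ v → count (λ a → w a ∧ allEntries w v) (range n)) (tuples m n)
      ≡⟨ sumBy-cong (tuples m n) (λ v → count-∧-const w (allEntries w v) (range n)) ⟩
    sumBy (λ v → indicator (allEntries w v) * count w (range n)) (tuples m n)
      ≡⟨ sumBy-*ʳ _ (indicator ∘ allEntries w) (tuples m n) ⟩
    count (allEntries w) (tuples m n) * count w (range n)
      ≡⟨ cong (_* count w (range n)) (count-tuples-allEntries m n w) ⟩
    count w (range n) ^ m * count w (range n)
      ≡⟨ *-comm _ (count w (range n)) ⟩
    count w (range n) ^ suc m                                                  ∎
    where open ≡-Reasoning

module LinearAlgebra where

  open import Data.Integer using (ℤ; +_; -_; 0ℤ; _+_; _*_; _-_; -1ℤ)
  open import Data.Integer.Properties renaming (_≟_ to _≟ℤ_)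
  import Data.Integer.Tactic.RingSolver as ℤ-Solver
  open import Data.Fin.Properties using (any?)
  open import Data.Fin.Properties using (suc-injective)
  open import Data.Fin.Subset using (∣_∣; _─_)
  open import Data.Fin.Subset.Properties
    using (_∈?_; nonempty?; p─q⊆p; x∈p∧x≢y⇒x∈p-y; x∈⁅x⁆; x∈⁅y⁆⇒x≡y; x∈p∪q⁻; ∪-identityʳ)
  open import Data.Sum using (inj₁; inj₂; [_,_]′)
  open import Data.Nat using (_≤_)
  import Data.Nat.Properties as ℕ
  open import Relation.Nullary using (_×-dec_; ¬?)

  ∣p∪⁅x⁆∣≡1+∣p∣ : ∀ {m} (p : Subset m) {x} → x ∉ˢ p → ∣ p ∪ ⁅ x ⁆ ∣ ≡ suc ∣ p ∣
  ∣p∪⁅x⁆∣≡1+∣p∣ (inside  ∷ p) {zero}  x∉p = ⊥-elim (x∉p here)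
  ∣p∪⁅x⁆∣≡1+∣p∣ (outside ∷ p) {zero}  x∉p = cong (suc ∘ ∣_∣) (∪-identityʳ p)
  ∣p∪⁅x⁆∣≡1+∣p∣ (inside  ∷ p) {suc x} x∉p = cong suc (∣p∪⁅x⁆∣≡1+∣p∣ p (x∉p ∘ there))
  ∣p∪⁅x⁆∣≡1+∣p∣ (outside ∷ p) {suc x} x∉p = ∣p∪⁅x⁆∣≡1+∣p∣ p (x∉p ∘ there)

  InKernel : ∀ {r m} → Matrix r m → (Fin m → ℤ) → Set
  InKernel A c = IsSolution A (λ _ → 0ℤ) c

  dot-congʳ : ∀ {m} (u : Fin m → ℤ) {v v′ : Fin m → ℤ} → v ≗ v′ → dot u v ≡ dot u v′
  dot-congʳ {zero}  u v≗v′ = refl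
  dot-congʳ {suc m} u v≗v′ = cong₂ _+_ (cong (u zero *_) (v≗v′ zero)) (dot-congʳ (u ∘ suc) (v≗v′ ∘ suc))

  dot-comm : ∀ {m} (u v : Fin m → ℤ) → dot u v ≡ dot v u
  dot-comm {zero}  u v = refl
  dot-comm {suc m} u v = cong₂ _+_ (*-comm (u zero) (v zero)) (dot-comm (u ∘ suc) (v ∘ suc))

  dot-+ʳ : ∀ {m} (u v w : Fin m → ℤ) → dot u (λ j → v j + w j) ≡ dot u v + dot u w
  dot-+ʳ {zero}  u v w = refl
  dot-+ʳ {suc m} u v w = trans (cong (_+_ (u zero * (v zero + w zero))) (dot-+ʳ (u ∘ suc) (v ∘ suc) (w ∘ suc)))
                               (distrib (u zero) (v zero) (w zero) _ _)
    where
    distrib : ∀ a b c d e → a * (b + c) + (d + e) ≡ a * b + d + (a * c + e)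
    distrib = ℤ-Solver.solve-∀

  dot-*ʳ : ∀ {m} (u v : Fin m → ℤ) c → dot u (λ j → c * v j) ≡ c * dot u v
  dot-*ʳ {zero}  u v c = sym (*-zeroʳ c)
  dot-*ʳ {suc m} u v c = trans (cong (_+_ (u zero * (c * v zero))) (dot-*ʳ (u ∘ suc) (v ∘ suc) c))
                               (distrib (u zero) (v zero) c _)
    where
    distrib : ∀ a b c d → a * (c * b) + c * d ≡ c * (a * b + d)
    distrib = ℤ-Solver.solve-∀

  dot-negʳ : ∀ {m} (u v : Fin m → ℤ) → dot u (λ j → - v j) ≡ - dot u v
  dot-negʳ u v = begin
    dot u (λ j → - v j)      ≡⟨ dot-congʳ u (λ j → sym (-1*i≡-i (v j))) ⟩
    dot u (λ j → -1ℤ * v j)  ≡⟨ dot-*ʳ u v -1ℤ ⟩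
    -1ℤ * dot u v            ≡⟨ -1*i≡-i (dot u v) ⟩
    - dot u v                ∎
    where open ≡-Reasoning

  dot-≡0 : ∀ {m} (u v : Fin m → ℤ) → (∀ j → u j * v j ≡ 0ℤ) → dot u v ≡ 0ℤ
  dot-≡0 {zero}  u v uv≡0 = refl
  dot-≡0 {suc m} u v uv≡0 = cong₂ _+_ (uv≡0 zero) (dot-≡0 (u ∘ suc) (v ∘ suc) (uv≡0 ∘ suc))

  dot-zeroʳ : ∀ {m} (u : Fin m → ℤ) {v} → (∀ j → v j ≡ 0ℤ) → dot u v ≡ 0ℤ
  dot-zeroʳ u v≡0 = dot-≡0 u _ (λ j → trans (cong (u j *_) (v≡0 j)) (*-zeroʳ (u j)))

  dot-zeroˡ : ∀ {m} {u : Fin m → ℤ} v → (∀ j → u j ≡ 0ℤ) → dot u v ≡ 0ℤ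
  dot-zeroˡ {u = u} v u≡0 = trans (dot-comm u v) (dot-zeroʳ v u≡0)

  dot-supported : ∀ {m} (u v : Fin m → ℤ) p → (∀ j → j ≢ p → v j ≡ 0ℤ) → dot u v ≡ u p * v p
  dot-supported u v zero v≡0 =
    trans (cong (_+_ (u zero * v zero)) (dot-zeroʳ (u ∘ suc) (λ j → v≡0 (suc j) (λ ())))) (+-identityʳ _)
  dot-supported u v (suc p) v≡0 =
    trans (cong₂ _+_ (trans (cong (u zero *_) (v≡0 zero (λ ()))) (*-zeroʳ (u zero)))
                     (dot-supported (u ∘ suc) (v ∘ suc) p (λ j j≢p → v≡0 (suc j) (j≢p ∘ suc-injective))))
          (+-identityˡ _)

  dot-transpose : ∀ {mi mj} (a : Fin mi → ℤ) (M : Fin mj → Fin mi → ℤ) (s : Fin mj → ℤ)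
    → dot a (λ i → dot (λ j → M j i) s) ≡ dot (λ j → dot a (M j)) s
  dot-transpose {mj = zero}   a M s = dot-zeroʳ a (λ _ → refl)
  dot-transpose {mj = suc mj} a M s = begin
    dot a (λ i → M zero i * s zero + dot (λ j → M (suc j) i) (s ∘ suc))
      ≡⟨ dot-+ʳ a (λ i → M zero i * s zero) (λ i → dot (λ j → M (suc j) i) (s ∘ suc)) ⟩
    dot a (λ i → M zero i * s zero) + dot a (λ i → dot (λ j → M (suc j) i) (s ∘ suc))
      ≡⟨ cong₂ _+_ head (dot-transpose a (M ∘ suc) (s ∘ suc)) ⟩
    dot a (M zero) * s zero + dot (λ j → dot a (M (suc j))) (s ∘ suc) ∎
    where
    open ≡-Reasoning
    head : dot a (λ i → M zero i * s zero) ≡ dot a (M zero) * s zero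
    head = begin
      dot a (λ i → M zero i * s zero)  ≡⟨ dot-congʳ a (λ i → *-comm (M zero i) (s zero)) ⟩
      dot a (λ i → s zero * M zero i)  ≡⟨ dot-*ʳ a (M zero) (s zero) ⟩
      s zero * dot a (M zero)          ≡⟨ *-comm (s zero) _ ⟩
      dot a (M zero) * s zero          ∎

  delta : ∀ {m} → Fin m → ℤ → Fin m → ℤ
  delta p t l = if does (l ≟ p) then t else 0ℤ

  delta-same : ∀ {m} (p : Fin m) t → delta p t p ≡ t
  delta-same p t with p ≟ p
  ... | yes _   = refl
  ... | no p≢p = ⊥-elim (p≢p refl)

  delta-other : ∀ {m} {p l : Fin m} t → l ≢ p → delta p t l ≡ 0ℤ
  delta-other {p = p} {l} t l≢p with l ≟ p
  ... | yes l≡p = ⊥-elim (l≢p l≡p)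
  ... | no _    = refl

  dot-delta : ∀ {m} (u : Fin m → ℤ) p t → dot u (delta p t) ≡ u p * t
  dot-delta u p t = trans (dot-supported u (delta p t) p (λ _ → delta-other t)) (cong (u p *_) (delta-same p t))

  dot-+delta : ∀ {m} (u c : Fin m → ℤ) p t → dot u (λ l → c l + delta p t l) ≡ dot u c + u p * t
  dot-+delta u c p t = trans (dot-+ʳ u c (delta p t)) (cong (_+_ (dot u c)) (dot-delta u p t))

  x∈p-y⇒x≢y : ∀ {m} {p : Subset m} {x y} → x ∈ˢ p ─ ⁅ y ⁆ → x ≢ y
  x∈p-y⇒x≢y {p = p} {y = y} x∈ refl = x∈p─q⇒x∉q p ⁅ y ⁆ x∈ (x∈⁅x⁆ y)
    where
    x∈p─q⇒x∉q : ∀ {m} (p q : Subset m) {x} → x ∈ˢ p ─ q → x ∉ˢ q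
    x∈p─q⇒x∉q (_ ∷ p) (outside ∷ q) here       ()
    x∈p─q⇒x∉q (_ ∷ p) (_ ∷ q)       (there x∈) (there x∈q) = x∈p─q⇒x∉q p q x∈ x∈q

  independent⇒zero : ∀ {r m} (A : Matrix r m) Q → ColumnsIndependent A Q
    → ∀ c → (∀ l → l ∉ˢ Q → c l ≡ 0ℤ) → InKernel A c → ∀ l → c l ≡ 0ℤ
  independent⇒zero A Q indep c supp c∈ker l with c l ≟ℤ 0ℤ
  ... | yes cl≡0 = cl≡0
  ... | no  cl≢0 = ⊥-elim (indep (c , supp , (l , cl≢0) , c∈ker))

  support⇒∈ : ∀ {m} {Q : Subset m} {c : Fin m → ℤ} → (∀ l → l ∉ˢ Q → c l ≡ 0ℤ) → ∀ {j} → c j ≢ 0ℤ → j ∈ˢ Q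
  support⇒∈ {Q = Q} supp {j} cj≢0 with j ∈? Q
  ... | yes j∈Q = j∈Q
  ... | no  j∉Q = ⊥-elim (cj≢0 (supp j j∉Q))

  *-≡0⇒≡0 : ∀ {a x : ℤ} → a ≢ 0ℤ → a * x ≡ 0ℤ → x ≡ 0ℤ
  *-≡0⇒≡0 {a} a≢0 ax≡0 with i*j≡0⇒i≡0∨j≡0 a ax≡0
  ... | inj₁ a≡0 = ⊥-elim (a≢0 a≡0)
  ... | inj₂ x≡0 = x≡0

  dependent-dropRow : ∀ {r m} (A : Matrix (suc r) m) Q
    → (∀ j → j ∈ˢ Q → A zero j ≡ 0ℤ) → ColumnsDependent (A ∘ suc) Q → ColumnsDependent A Q
  dependent-dropRow A Q row₀≡0 (c , supp , nonzero , c∈ker) = c , supp , nonzero , c∈ker′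
    where
    vanish : ∀ j → A zero j * c j ≡ 0ℤ
    vanish j with j ∈? Q
    ... | yes j∈Q = trans (cong (_* c j) (row₀≡0 j j∈Q)) (*-zeroˡ (c j))
    ... | no  j∉Q = trans (cong (A zero j *_) (supp j j∉Q)) (*-zeroʳ (A zero j))
    c∈ker′ : InKernel A c
    c∈ker′ zero    = dot-≡0 (A zero) c vanish
    c∈ker′ (suc i) = c∈ker i

  module Elimination {r m} (A : Matrix (suc r) m) (p : Fin m) where

    eliminate : Matrix r m
    eliminate i j = A zero p * A (suc i) j + (- A (suc i) p) * A zero j

    dot-eliminate : ∀ i c → dot (eliminate i) c ≡ A zero p * dot (A (suc i)) c + (- A (suc i) p) * dot (A zero) c
    dot-eliminate i c = begin
      dot (eliminate i) c
        ≡⟨ dot-comm (eliminate i) c ⟩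
      dot c (λ j → a * A (suc i) j + b * A zero j)
        ≡⟨ dot-+ʳ c _ _ ⟩
      dot c (λ j → a * A (suc i) j) + dot c (λ j → b * A zero j)
                                                           ≡⟨ cong₂ _+_ (dot-*ʳ c (A (suc i)) a) (dot-*ʳ c (A zero) b) ⟩
      a * dot c (A (suc i)) + b * dot c (A zero)
        ≡⟨ cong₂ (λ x y → a * x + b * y) (dot-comm c _) (dot-comm c _) ⟩
      a * dot (A (suc i)) c + b * dot (A zero) c           ∎
      where
      open ≡-Reasoning
      a = A zero p
      b = - A (suc i) p

    dependent⁺ : ∀ Q → p ∈ˢ Q → A zero p ≢ 0ℤ → ColumnsDependent eliminate (Q ─ ⁅ p ⁆) → ColumnsDependent A Q
    dependent⁺ Q p∈Q a≢0 (c′ , supp′ , (j , c′j≢0) , c′∈ker) = c , supp , (j , cj≢0) , c∈ker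
      where
      a = A zero p
      t = - dot (A zero) c′
      c : Fin m → ℤ
      c l = a * c′ l + delta p t l
      dot-c : ∀ u → dot u c ≡ a * dot u c′ + u p * t
      dot-c u = trans (dot-+delta u (λ l → a * c′ l) p t) (cong (_+ u p * t) (dot-*ʳ u c′ a))
      supp : ∀ l → l ∉ˢ Q → c l ≡ 0ℤ
      supp l l∉Q = cong₂ _+_ (trans (cong (a *_) (supp′ l (l∉Q ∘ p─q⊆p Q ⁅ p ⁆))) (*-zeroʳ a))
                             (delta-other t (λ l≡p → l∉Q (subst (_∈ˢ Q) (sym l≡p) p∈Q)))
      cj≢0 : c j ≢ 0ℤ
      cj≢0 cj≡0 = c′j≢0 (*-≡0⇒≡0 a≢0 (trans (sym (+-identityʳ _))
        (trans (cong (_+_ (a * c′ j)) (sym (delta-other t (x∈p-y⇒x≢y (support⇒∈ supp′ c′j≢0))))) cj≡0)))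
      cancel : ∀ a d → a * d + a * (- d) ≡ 0ℤ
      cancel = ℤ-Solver.solve-∀
      move-neg : ∀ a x b d → a * x + b * (- d) ≡ a * x + (- b) * d
      move-neg = ℤ-Solver.solve-∀
      c∈ker : InKernel A c
      c∈ker zero    = trans (dot-c (A zero)) (cancel a (dot (A zero) c′))
      c∈ker (suc i) = begin
        dot (A (suc i)) c                                             ≡⟨ dot-c (A (suc i)) ⟩
        a * dot (A (suc i)) c′ + A (suc i) p * t                      ≡⟨ move-neg a _ (A (suc i) p) _ ⟩
        a * dot (A (suc i)) c′ + (- A (suc i) p) * dot (A zero) c′    ≡⟨ dot-eliminate i c′ ⟨
        dot (eliminate i) c′                                          ≡⟨ c′∈ker i ⟩
        0ℤ                                                            ∎
        where open ≡-Reasoning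

    independent⁺ : ∀ Q → A zero p ≢ 0ℤ → ColumnsIndependent eliminate (Q ─ ⁅ p ⁆) → ColumnsIndependent A Q
    independent⁺ Q a≢0 indep′ (c , supp , (j , cj≢0) , c∈ker) = cj≢0 cj≡0
      where
      a = A zero p
      c′ : Fin m → ℤ
      c′ l = c l + delta p (- c p) l
      dot-c′ : ∀ u → dot u c′ ≡ dot u c + u p * (- c p)
      dot-c′ u = dot-+delta u c p (- c p)
      supp′ : ∀ l → l ∉ˢ Q ─ ⁅ p ⁆ → c′ l ≡ 0ℤ
      supp′ l l∉ with l ≟ p
      ... | yes refl = +-inverseʳ (c p)
      ... | no  l≢p  = trans (cong (_+ 0ℤ) (supp l (λ l∈Q → l∉ (x∈p∧x≢y⇒x∈p-y l∈Q l≢p)))) refl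
      vanish : ∀ a b x → a * (0ℤ + b * (- x)) + (- b) * (0ℤ + a * (- x)) ≡ 0ℤ
      vanish = ℤ-Solver.solve-∀
      restrict : ∀ i′ → dot (A i′) c′ ≡ 0ℤ + A i′ p * (- c p)
      restrict i′ = trans (dot-c′ (A i′)) (cong (_+ A i′ p * (- c p)) (c∈ker i′))
      c′∈ker : InKernel eliminate c′
      c′∈ker i = begin
        dot (eliminate i) c′
          ≡⟨ dot-eliminate i c′ ⟩
        a * dot (A (suc i)) c′ + (- A (suc i) p) * dot (A zero) c′
          ≡⟨ cong₂ (λ x y → a * x + (- A (suc i) p) * y) (restrict (suc i)) (restrict zero) ⟩
        a * (0ℤ + A (suc i) p * (- c p)) + (- A (suc i) p) * (0ℤ + a * (- c p))
          ≡⟨ vanish a (A (suc i) p) (c p) ⟩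
        0ℤ ∎
        where open ≡-Reasoning
      c′≡0 : ∀ l → c′ l ≡ 0ℤ
      c′≡0 = independent⇒zero eliminate (Q ─ ⁅ p ⁆) indep′ c′ supp′ c′∈ker
      cp≡0 : c p ≡ 0ℤ
      cp≡0 = trans (sym (neg-involutive (c p))) (cong -_ (*-≡0⇒≡0 a≢0 (begin
        a * (- c p)        ≡⟨ +-identityˡ _ ⟨
        0ℤ + a * (- c p)   ≡⟨ restrict zero ⟨
        dot (A zero) c′    ≡⟨ dot-zeroʳ (A zero) c′≡0 ⟩
        0ℤ                 ∎)))
        where open ≡-Reasoning
      cj≡0 : c j ≡ 0ℤ
      cj≡0 with j ≟ p
      ... | yes refl = cp≡0
      ... | no  j≢p  = trans (sym (+-identityʳ (c j))) (trans (cong (_+_ (c j)) (sym (delta-other (- c p) j≢p))) (c′≡0 j))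

  columnsDependent? : ∀ {r m} (A : Matrix r m) Q → Dec (ColumnsDependent A Q)
  columnsDependent? {zero} A Q with nonempty? Q
  ... | yes (j , j∈Q) = yes (delta j (+ 1) , supp , (j , ej≢0) , λ ())
    where
    supp : ∀ l → l ∉ˢ Q → delta j (+ 1) l ≡ 0ℤ
    supp l l∉Q = delta-other (+ 1) (λ l≡j → l∉Q (subst (_∈ˢ Q) (sym l≡j) j∈Q))
    ej≢0 : delta j (+ 1) j ≢ 0ℤ
    ej≢0 ej≡0 with trans (sym (delta-same j (+ 1))) ej≡0
    ... | ()
  ... | no  Q-empty = no λ (c , supp , (j , cj≢0) , _) → Q-empty (j , support⇒∈ supp cj≢0)
  columnsDependent? {suc r} A Q with any? (λ p → (p ∈? Q) ×-dec ¬? (A zero p ≟ℤ 0ℤ))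
  ... | yes (p , p∈Q , a≢0) with columnsDependent? (eliminate) (Q ─ ⁅ p ⁆)
    where open Elimination A p
  ...   | yes dep   = yes (dependent⁺ Q p∈Q a≢0 dep) where open Elimination A p
  ...   | no  indep = no (independent⁺ Q a≢0 indep) where open Elimination A p
  columnsDependent? {suc r} A Q | no no-pivot with columnsDependent? (A ∘ suc) Q
  ... | yes dep   = yes (dependent-dropRow A Q row₀≡0 dep)
    where
    row₀≡0 : ∀ j → j ∈ˢ Q → A zero j ≡ 0ℤ
    row₀≡0 j j∈Q with A zero j ≟ℤ 0ℤ
    ... | yes a≡0 = a≡0
    ... | no  a≢0 = ⊥-elim (no-pivot (j , j∈Q , a≢0))
  ... | no  indep = no λ (c , supp , nonzero , c∈ker) → indep (c , supp , nonzero , c∈ker ∘ suc)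

  MaximalIndependent : ∀ {r m} → Matrix r m → Subset m → Set
  MaximalIndependent {m = m} A Q = ColumnsIndependent A Q × (∀ (Q′ : Subset m) → ColumnsIndependent A Q′ → ∣ Q′ ∣ ≤ ∣ Q ∣)

  kernelVector : ∀ {r m} (A : Matrix r m) Q → MaximalIndependent A Q
    → ∀ j → j ∉ˢ Q → ∃ λ c → (∀ l → l ∉ˢ Q → l ≢ j → c l ≡ 0ℤ) × c j ≢ 0ℤ × InKernel A c
  kernelVector A Q (indep , maximal) j j∉Q with columnsDependent? A (Q ∪ ⁅ j ⁆)
  ... | no  indep′ = ⊥-elim (ℕ.<-irrefl refl (ℕ.≤-trans (ℕ.≤-reflexive (sym (∣p∪⁅x⁆∣≡1+∣p∣ Q j∉Q))) (maximal _ indep′)))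
  ... | yes (c , supp , (l , cl≢0) , c∈ker) = c , supp′ , cj≢0 , c∈ker
    where
    supp′ : ∀ l → l ∉ˢ Q → l ≢ j → c l ≡ 0ℤ
    supp′ l l∉Q l≢j = supp l λ l∈ → [ l∉Q , l≢j ∘ x∈⁅y⁆⇒x≡y j ]′ (x∈p∪q⁻ Q ⁅ j ⁆ l∈)
    cj≢0 : c j ≢ 0ℤ
    cj≢0 cj≡0 = indep (c , suppQ , (l , cl≢0) , c∈ker)
      where
      suppQ : ∀ l → l ∉ˢ Q → c l ≡ 0ℤ
      suppQ l l∉Q with l ≟ j
      ... | yes refl = cj≡0
      ... | no  l≢j  = supp′ l l∉Q l≢j

  solutions-agreeOutside : ∀ {r m} (A : Matrix r m) b Q → ColumnsIndependent A Q
    → ∀ x x′ → IsSolution A b x → IsSolution A b x′ → (∀ l → l ∉ˢ Q → x l ≡ x′ l) → ∀ l → x l ≡ x′ l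
  solutions-agreeOutside A b Q indep x x′ x-sol x′-sol agree l =
    i-j≡0⇒i≡j (x l) (x′ l) (independent⇒zero A Q indep (λ l → x l - x′ l) supp diff∈ker l)
    where
    supp : ∀ l → l ∉ˢ Q → x l - x′ l ≡ 0ℤ
    supp l l∉Q = trans (cong (_- x′ l) (agree l l∉Q)) (+-inverseʳ (x′ l))
    diff∈ker : InKernel A (λ l → x l - x′ l)
    diff∈ker i = begin
      dot (A i) (λ l → x l - x′ l)         ≡⟨ dot-+ʳ (A i) x (λ l → - x′ l) ⟩
      dot (A i) x + dot (A i) (λ l → - x′ l) ≡⟨ cong (_+_ (dot (A i) x)) (dot-negʳ (A i) x′) ⟩
      dot (A i) x - dot (A i) x′            ≡⟨ cong₂ _-_ (x-sol i) (x′-sol i) ⟩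
      b i - b i                            ≡⟨ +-inverseʳ (b i) ⟩
      0ℤ                                   ∎
      where open ≡-Reasoning

module Parametrisation where

  open LinearAlgebra
  open import Data.Integer using (ℤ; +_; -[1+_]; _+_; _*_; ∣_∣; _<_; +<+)
  import Data.Integer.Tactic.RingSolver as ℤ-Solver
  import Data.Nat.Tactic.RingSolver as ℕ-Solver
  open import Data.Integer.Properties
    using (∣i+j∣≤∣i∣+∣j∣; abs-*; pos-*; pos-+; ⊖-≥; *-zeroʳ; +-identityʳ; +-injective; *-cancelʳ-≡; +-0-abelianGroup)
  open import Data.Integer.Base using (≢-nonZero)
  open import Algebra.Bundles using (AbelianGroup)
  open import Algebra.Properties.Group (AbelianGroup.group +-0-abelianGroup) using () renaming (∙-cancelˡ to +-cancelˡ-≡)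
  open import Data.Nat as ℕ using (_≤_; z≤n; s≤s)
  import Data.Nat.Properties as ℕ
  open import Data.Fin.Subset.Properties using (_∈?_)

  ∑ : ∀ {m} → (Fin m → ℕ) → ℕ
  ∑ {zero}  f = 0
  ∑ {suc m} f = f zero ℕ.+ ∑ (f ∘ suc)

  ≤-∑ : ∀ {m} (f : Fin m → ℕ) i → f i ≤ ∑ f
  ≤-∑ f zero    = ℕ.m≤m+n _ _
  ≤-∑ f (suc i) = ℕ.≤-trans (≤-∑ (f ∘ suc) i) (ℕ.m≤n+m _ _)

  ∣dot∣≤ : ∀ {m} (u : Fin m → ℤ) (s : Fin m → ℕ) L → (∀ j → s j ≤ L) → ∣ dot u (λ j → + s j) ∣ ≤ L ℕ.* ∑ (∣_∣ ∘ u)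
  ∣dot∣≤ {zero}  u s L s≤L = z≤n
  ∣dot∣≤ {suc m} u s L s≤L = begin
    ∣ u zero * + s zero + dot (u ∘ suc) (λ j → + s (suc j)) ∣
      ≤⟨ ∣i+j∣≤∣i∣+∣j∣ (u zero * + s zero) _ ⟩
    ∣ u zero * + s zero ∣ ℕ.+ ∣ dot (u ∘ suc) (λ j → + s (suc j)) ∣
      ≤⟨ ℕ.+-mono-≤ head (∣dot∣≤ (u ∘ suc) (s ∘ suc) L (s≤L ∘ suc)) ⟩
    L ℕ.* ∣ u zero ∣ ℕ.+ L ℕ.* ∑ (∣_∣ ∘ u ∘ suc)
      ≡⟨ ℕ.*-distribˡ-+ L ∣ u zero ∣ _ ⟨
    L ℕ.* ∑ (∣_∣ ∘ u)                                                 ∎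
    where
    open ℕ.≤-Reasoning
    head : ∣ u zero * + s zero ∣ ≤ L ℕ.* ∣ u zero ∣
    head = ℕ.≤-trans (ℕ.≤-reflexive (trans (abs-* (u zero) (+ s zero)) (ℕ.*-comm ∣ u zero ∣ (s zero))))
                     (ℕ.*-monoˡ-≤ ∣ u zero ∣ (s≤L zero))

  m<[1+m]*n : ∀ m n → 1 ≤ n → m ℕ.< suc m ℕ.* n
  m<[1+m]*n m n 1≤n = ℕ.≤-trans (ℕ.≤-reflexive (sym (ℕ.*-identityʳ (suc m)))) (ℕ.*-monoʳ-≤ (suc m) 1≤n)

  positive-shift : ∀ t Y u (e : ℤ) → 1 ≤ u → u ≤ Y → ∣ e ∣ ≤ t
    → ∃ λ X → + (suc t ℕ.* u) + e ≡ + X × 1 ≤ X × X ≤ suc t ℕ.* Y ℕ.+ t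
  positive-shift t Y u (+ e) 1≤u u≤Y e≤t =
    N ℕ.+ e , sym (pos-+ N e) , ℕ.≤-trans (ℕ.≤-trans (s≤s z≤n) (m<[1+m]*n t u 1≤u)) (ℕ.m≤m+n N e) ,
    ℕ.+-mono-≤ (ℕ.*-monoʳ-≤ (suc t) u≤Y) e≤t
    where N = suc t ℕ.* u
  positive-shift t Y u -[1+ e ] 1≤u u≤Y 1+e≤t =
    N ℕ.∸ suc e , ⊖-≥ (ℕ.<⇒≤ 1+e<N) , ℕ.m<n⇒0<n∸m 1+e<N ,
    ℕ.≤-trans (ℕ.m∸n≤m N (suc e)) (ℕ.≤-trans (ℕ.*-monoʳ-≤ (suc t) u≤Y) (ℕ.m≤m+n _ t))
    where
    N = suc t ℕ.* u
    1+e<N : suc e ℕ.< N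
    1+e<N = ℕ.≤-<-trans 1+e≤t (m<[1+m]*n t u 1≤u)

  module Family {r m} (A : Matrix r m) (b : Fin r → ℤ) (Q : Subset m) (Q-max : MaximalIndependent A Q)
                (y : Fin m → ℤ) (y-pos : ∀ j → + 0 < y j) (y∈ker : InKernel A y)
                (x₀ : Fin m → ℤ) (x₀-sol : IsSolution A b x₀) where

    C′ : ∀ j → Dec (j ∈ˢ Q) → Fin m → ℤ
    C′ j (yes _)  = λ _ → + 0
    C′ j (no j∉Q) = proj₁ (kernelVector A Q Q-max j j∉Q)

    C : Fin m → Fin m → ℤ
    C j = C′ j (j ∈? Q)

    C∈ker : ∀ j → InKernel A (C j)
    C∈ker j with j ∈? Q
    ... | yes _   = λ i → dot-zeroʳ (A i) (λ _ → refl)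
    ... | no j∉Q = proj₂ (proj₂ (proj₂ (kernelVector A Q Q-max j j∉Q)))

    C-offDiagonal : ∀ l → l ∉ˢ Q → ∀ j → j ≢ l → C j l ≡ + 0
    C-offDiagonal l l∉Q j j≢l with j ∈? Q
    ... | yes _   = refl
    ... | no j∉Q = proj₁ (proj₂ (kernelVector A Q Q-max j j∉Q)) l l∉Q (j≢l ∘ sym)

    C-diagonal : ∀ l → l ∉ˢ Q → C l l ≢ + 0
    C-diagonal l l∉Q with l ∈? Q
    ... | yes l∈Q = ⊥-elim (l∉Q l∈Q)
    ... | no l∉Q′ = proj₁ (proj₂ (proj₂ (kernelVector A Q Q-max l l∉Q′)))

    ψ : ℕ → (Fin m → ℕ) → Fin m → ℤ
    ψ T s i = x₀ i + + T * y i + dot (λ j → C j i) (λ j → + s j)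

    ψ-sol : ∀ T s → IsSolution A b (ψ T s)
    ψ-sol T s i′ = begin
      dot (A i′) (ψ T s)
        ≡⟨ dot-+ʳ (A i′) (λ i → x₀ i + + T * y i) (λ i → dot (λ j → C j i) s′) ⟩
      dot (A i′) (λ i → x₀ i + + T * y i) + dot (A i′) (λ i → dot (λ j → C j i) s′)
        ≡⟨ cong₂ _+_ (dot-+ʳ (A i′) x₀ (λ i → + T * y i)) (dot-transpose (A i′) C s′) ⟩
      dot (A i′) x₀ + dot (A i′) (λ i → + T * y i) + dot (λ j → dot (A i′) (C j)) s′
        ≡⟨ cong₂ _+_ (cong₂ _+_ (x₀-sol i′) (trans (dot-*ʳ (A i′) y (+ T)) (cong (+ T *_) (y∈ker i′))))
                     (dot-zeroˡ s′ (λ j → C∈ker j i′)) ⟩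
      b i′ + + T * + 0 + + 0
        ≡⟨ trans (+-identityʳ _) (trans (cong (_+_ (b i′)) (*-zeroʳ (+ T))) (+-identityʳ (b i′))) ⟩
      b i′ ∎
      where
      open ≡-Reasoning
      s′ : Fin m → ℤ
      s′ j = + s j

    φ : ℕ → Fin m → ℕ → ℤ
    φ T l a = x₀ l + + T * y l + + a * C l l

    ψ-diagonal : ∀ T s l → l ∉ˢ Q → ψ T s l ≡ φ T l (s l)
    ψ-diagonal T s l l∉Q = cong (_+_ (x₀ l + + T * y l))
      (trans (dot-comm (λ j → C j l) (λ j → + s j)) (dot-supported (λ j → + s j) (λ j → C j l) l (C-offDiagonal l l∉Q)))

    φ-injective : ∀ T l → l ∉ˢ Q → ∀ {a a′} → φ T l a ≡ φ T l a′ → a ≡ a′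
    φ-injective T l l∉Q {a} {a′} eq = +-injective (*-cancelʳ-≡ (+ a) (+ a′) (C l l) ⦃ ≢-nonZero (C-diagonal l l∉Q) ⦄
      (+-cancelˡ-≡ (x₀ l + + T * y l) _ _ eq))

    B G Y H : ℕ
    B = ∑ (∣_∣ ∘ x₀)
    G = ∑ (λ i → ∑ (λ j → ∣ C j i ∣))
    Y = ∑ (∣_∣ ∘ y)
    H = suc (B ℕ.+ G) ℕ.* suc Y

    -- shift L exceeds |x₀ i + Σⱼ sⱼ Cⱼ i| whenever all sⱼ ≤ L, so adding shift L · y
    -- makes every entry positive.
    shift : ℕ → ℕ
    shift L = suc (B ℕ.+ L ℕ.* G)

    ψ-range : ∀ L s → (∀ j → s j ≤ L) → ∀ i → ∃ λ X → ψ (shift L) s i ≡ + X × 1 ≤ X × X ≤ suc L ℕ.* H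
    ψ-range L s s≤L i with y i in yᵢ-eq | y-pos i
    ... | + yᵢ | +<+ 1≤yᵢ with positive-shift t Y yᵢ (x₀ i + S) 1≤yᵢ yᵢ≤Y error≤t
      where
      t = B ℕ.+ L ℕ.* G
      S = dot (λ j → C j i) (λ j → + s j)
      yᵢ≤Y : yᵢ ≤ Y
      yᵢ≤Y = subst (λ z → ∣ z ∣ ≤ Y) yᵢ-eq (≤-∑ (∣_∣ ∘ y) i)
      error≤t : ∣ x₀ i + S ∣ ≤ t
      error≤t = ℕ.≤-trans (∣i+j∣≤∣i∣+∣j∣ (x₀ i) S)
        (ℕ.+-mono-≤ (≤-∑ (∣_∣ ∘ x₀) i)
                    (ℕ.≤-trans (∣dot∣≤ (λ j → C j i) s L s≤L) (ℕ.*-monoʳ-≤ L (≤-∑ (λ i → ∑ (λ j → ∣ C j i ∣)) i))))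
    ... | X , eq , 1≤X , X≤ = X , trans ψ≡ eq , 1≤X , ℕ.≤-trans X≤ (ℕ.≤-trans (ℕ.m≤m+n _ _) (ℕ.≤-reflexive (sym (expand B G L Y))))
      where
      S = dot (λ j → C j i) (λ j → + s j)
      expand : ∀ B G L Y → suc L ℕ.* (suc (B ℕ.+ G) ℕ.* suc Y)
                         ≡ suc (B ℕ.+ L ℕ.* G) ℕ.* Y ℕ.+ (B ℕ.+ L ℕ.* G) ℕ.+ suc (suc Y ℕ.* (G ℕ.+ L ℕ.+ L ℕ.* B))
      expand = ℕ-Solver.solve-∀
      regroup : ∀ a b c → a + b + c ≡ b + (a + c)
      regroup = ℤ-Solver.solve-∀
      ψ≡ : x₀ i + + shift L * + yᵢ + S ≡ + (shift L ℕ.* yᵢ) + (x₀ i + S)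
      ψ≡ = trans (regroup (x₀ i) _ S) (cong (_+ (x₀ i + S)) (sym (pos-* (shift L) yᵢ)))

    onlyAt : Fin m → ℕ → Fin m → ℕ
    onlyAt l a j = if does (j ≟ l) then a else 0

    onlyAt-same : ∀ l a → onlyAt l a l ≡ a
    onlyAt-same l a with l ≟ l
    ... | yes _   = refl
    ... | no l≢l = ⊥-elim (l≢l refl)

    onlyAt≤ : ∀ l a L → a ≤ L → ∀ j → onlyAt l a j ≤ L
    onlyAt≤ l a L a≤L j with j ≟ l
    ... | yes _ = a≤L
    ... | no  _ = z≤n

    φ-range : ∀ L l → l ∉ˢ Q → ∀ a → a ≤ L → ∃ λ X → φ (shift L) l a ≡ + X × 1 ≤ X × X ≤ suc L ℕ.* H
    φ-range L l l∉Q a a≤L =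
      let X , ψ≡X , bounds = ψ-range L (onlyAt l a) (onlyAt≤ l a L a≤L) l
      in X , trans φ≡ψ ψ≡X , bounds
      where
      φ≡ψ : φ (shift L) l a ≡ ψ (shift L) (onlyAt l a) l
      φ≡ψ = trans (cong (φ (shift L) l) (sym (onlyAt-same l a))) (sym (ψ-diagonal (shift L) (onlyAt l a) l l∉Q))

module Solutions where

  open Counting
  open LinearAlgebra using (InKernel; MaximalIndependent; solutions-agreeOutside; ∣p∪⁅x⁆∣≡1+∣p∣; dot-congʳ)
  open Parametrisation using (module Family)
  open import Data.Integer as ℤ using (ℤ; +_)
  import Data.Integer.Properties as ℤ
  open import Data.Nat using (_+_; _*_; _∸_; _^_; _≤_; _<_; z≤n; s≤s; _≡ᵇ_)
  open import Data.Nat.Properties hiding (_≟_)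
  open import Data.Fin.Properties using (¬∀⟶∃¬)
  open import Data.Bool.Properties using (T-∧; T-≡; T-not-≡)
  open import Data.List.Properties using (length-tabulate; length-deduplicate)
  import Data.Vec as Vec
  open import Data.Vec.Properties using (lookup∘tabulate; ≡-dec)
  open import Function using (id)
  open import Data.Fin.Subset using (∣_∣)
  open import Data.Fin.Subset.Properties
    using (_∈?_; ⊆⊤; ∣p∣≤n; ∣∁p∣≡n∸∣p∣; ∣⁅x⁆∣≡1; x∈p∪q⁺; x∈p∪q⁻; x∈⁅x⁆; x∈⁅y⁆⇒x≡y; x∈p⇒x∉∁p)
  open import Data.Sum using (_⊎_; inj₁; inj₂; [_,_]′)
  open import Data.Nat.DivMod using (_/_; _%_; m≡m%n+[m/n]*n; m%n<n; m/n*n≤m; m≥n⇒m/n>0)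
  import Data.Nat.Tactic.RingSolver as ℕ-Solver

  IsSolutionℕ : ∀ {r m} → Matrix r m → (Fin r → ℤ) → (Fin m → ℕ) → Set
  IsSolutionℕ A b x = IsSolution A b (λ j → + x j)

  solᵇ⇒IsSolution : ∀ {r m} (A : Matrix r m) b (x : Fin m → ℕ) → T (solᵇ A b x) → IsSolutionℕ A b x
  solᵇ⇒IsSolution {r} A b x sol i =
    T-does⁻ (mul A (λ j → + x j) i ℤ.≟ b i) (All.lookup (all⁺ _ (allFin r) sol) (∈-allFin i))

  IsSolution⇒solᵇ : ∀ {r m} (A : Matrix r m) b (x : Fin m → ℕ) → IsSolutionℕ A b x → T (solᵇ A b x)
  IsSolution⇒solᵇ {r} A b x sol =
    all⁻ _ {xs = allFin r} (All.tabulate (λ {i} _ → T-does⁺ (mul A (λ j → + x j) i ℤ.≟ b i) (sol i)))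

  solᵇ-resp : ∀ {r m} (A : Matrix r m) b (x x′ : Fin m → ℕ) → (∀ l → x l ≡ x′ l) → T (solᵇ A b x) → T (solᵇ A b x′)
  solᵇ-resp A b x x′ x≗x′ sol = IsSolution⇒solᵇ A b x′ λ i →
    trans (dot-congʳ (A i) (λ l → cong +_ (sym (x≗x′ l)))) (solᵇ⇒IsSolution A b x sol i)

  rank⇒maximalIndependent : ∀ {r m} (A : Matrix r m) k → Rank A k → ∃ λ Q → ∣ Q ∣ ≡ k × MaximalIndependent A Q
  rank⇒maximalIndependent A k ((Q , _ , ∣Q∣≡k , indep) , maximal) =
    Q , ∣Q∣≡k , indep , λ Q′ indep′ → subst (∣ Q′ ∣ ≤_) (sym ∣Q∣≡k) (maximal Q′ ⊆⊤ indep′)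

  rank-unique : ∀ {r m} (A : Matrix r m) {k k′} → Rank A k → Rank A k′ → k ≡ k′
  rank-unique A ((Q , _ , ∣Q∣≡k , indep) , maximal) ((Q′ , _ , ∣Q′∣≡k′ , indep′) , maximal′) =
    ≤-antisym (subst (_≤ _) ∣Q∣≡k (maximal′ Q ⊆⊤ indep)) (subst (_≤ _) ∣Q′∣≡k′ (maximal Q′ ⊆⊤ indep′))

  positive⇒rank<m : ∀ {r m} (A : Matrix r m) k → Positive A → 0 < k → Rank A k → k < m
  positive⇒rank<m {m = m} A k (y , y-pos , y∈ker) 0<k ((Q , _ , ∣Q∣≡k , indep) , _)
    with ¬∀⟶∃¬ m (_∈ˢ Q) (_∈? Q) Q-not-full
    where
    Q-not-full : ¬ (∀ l → l ∈ˢ Q)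
    Q-not-full Q-full = indep (y , (λ l l∉Q → ⊥-elim (l∉Q (Q-full l))) , (l₀ , y≢0 l₀) , y∈ker)
      where
      y≢0 : ∀ l → y l ≢ + 0
      y≢0 l yl≡0 with y l | y-pos l
      y≢0 l refl | _ | ℤ.+<+ ()
      l₀ : Fin m
      l₀ = fromℕ< (≤-trans 0<k (≤-trans (≤-reflexive (sym ∣Q∣≡k)) (∣p∣≤n Q)))
  ... | l , l∉Q = subst (_< m) ∣Q∣≡k (≤-trans (≤-reflexive (sym (∣p∪⁅x⁆∣≡1+∣p∣ Q l∉Q))) (∣p∣≤n (Q ∪ ⁅ l ⁆)))

  solutions-determinedOutside : ∀ {r m} (A : Matrix r m) b Q → ColumnsIndependent A Q → DeterminedOutside Q (solᵇ A b)
  solutions-determinedOutside A b Q indep x x′ sol sol′ agree l =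
    ℤ.+-injective (solutions-agreeOutside A b Q indep _ _ (solᵇ⇒IsSolution A b x sol) (solᵇ⇒IsSolution A b x′ sol′)
                                            (λ l l∉Q → cong +_ (agree l l∉Q)) l)

  count-solutions≤ : ∀ {r m} (A : Matrix r m) b n Q → ColumnsIndependent A Q
    → count (solᵇ A b) (tuples m n) ≤ n ^ (m ∸ ∣ Q ∣)
  count-solutions≤ {m = m} A b n Q indep =
    subst (count (solᵇ A b) (tuples m n) ≤_) (cong (n ^_) (∣∁p∣≡n∸∣p∣ Q))
          (count-tuples≤ m n Q (solᵇ A b) (solutions-determinedOutside A b Q indep))

  coincideᵇ : ∀ {m} → Fin m → Fin m → (Fin m → ℕ) → Bool
  coincideᵇ i i′ x = not (does (i ≟ i′)) ∧ (x i ≡ᵇ x i′)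

  coincidentSolutions-determinedOutside : ∀ {r m} (A : Matrix r m) b Q → ColumnsIndependent A Q
    → ∀ {i i′} → i ≢ i′ → i ∉ˢ Q → i′ ∉ˢ Q
    → DeterminedOutside (Q ∪ ⁅ i ⁆) (λ x → solᵇ A b x ∧ coincideᵇ i i′ x)
  coincidentSolutions-determinedOutside A b Q indep {i} {i′} i≢i′ i∉Q i′∉Q x x′ px px′ agree =
    solutions-determinedOutside A b Q indep x x′ sol sol′ agreeQ
    where
    split : ∀ {x} → T (solᵇ A b x ∧ coincideᵇ i i′ x) → T (solᵇ A b x) × x i ≡ x i′
    split {x} p with Equivalence.to (T-∧ {solᵇ A b x}) p
    ... | sol , c = sol , ≡ᵇ⇒≡ _ _ (proj₂ (Equivalence.to (T-∧ {not (does (i ≟ i′))}) c))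
    sol = proj₁ (split px)
    sol′ = proj₁ (split px′)
    ∉Q∪i : ∀ {l} → l ∉ˢ Q → l ≢ i → l ∉ˢ Q ∪ ⁅ i ⁆
    ∉Q∪i l∉Q l≢i l∈ = [ l∉Q , l≢i ∘ x∈⁅y⁆⇒x≡y _ ]′ (x∈p∪q⁻ Q ⁅ i ⁆ l∈)
    agreeQ : AgreeOutside Q x x′
    agreeQ l l∉Q with l ≟ i
    ... | yes refl = trans (proj₂ (split px)) (trans (agree i′ (∉Q∪i i′∉Q (i≢i′ ∘ sym))) (sym (proj₂ (split px′))))
    ... | no  l≢i  = agree l (∉Q∪i l∉Q l≢i)

  m∸[1+n]≡m∸n∸1 : ∀ m n → m ∸ suc n ≡ m ∸ n ∸ 1
  m∸[1+n]≡m∸n∸1 m n = trans (cong (m ∸_) (+-comm 1 n)) (sym (∸-+-assoc m n 1))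

  -- Abundance gives k independent columns avoiding i and i′; on solutions with xᵢ = xᵢ′
  -- the coordinate i is then determined as well.
  count-coincident≤ : ∀ {r m} (A : Matrix r m) b k → Abundant A → Rank A k → ∀ n {i i′} → i ≢ i′
    → count (λ x → solᵇ A b x ∧ coincideᵇ i i′ x) (tuples m n) ≤ n ^ (m ∸ k ∸ 1)
  count-coincident≤ {m = m} A b k (k′ , rank′ , _ , abundant) rank n {i} {i′} i≢i′
    with abundant (∁ pair) (≤-reflexive (sym ∣∁pair∣≡m∸2))
    where
    pair = ⁅ i′ ⁆ ∪ ⁅ i ⁆
    ∣∁pair∣≡m∸2 : ∣ ∁ pair ∣ ≡ m ∸ 2
    ∣∁pair∣≡m∸2 = trans (∣∁p∣≡n∸∣p∣ pair)
                  (cong (m ∸_) (trans (∣p∪⁅x⁆∣≡1+∣p∣ ⁅ i′ ⁆ (i≢i′ ∘ x∈⁅y⁆⇒x≡y i′)) (cong suc (∣⁅x⁆∣≡1 i′))))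
  ... | (Q , Q⊆∁pair , ∣Q∣≡k′ , indep) , _ =
    subst (count _ (tuples m n) ≤_) (cong (n ^_) dimension)
      (count-tuples≤ m n (Q ∪ ⁅ i ⁆) _
        (coincidentSolutions-determinedOutside A b Q indep i≢i′ (∉Q (inj₂ (x∈⁅x⁆ i))) (∉Q (inj₁ (x∈⁅x⁆ i′)))))
    where
    ∉Q : ∀ {l} → l ∈ˢ ⁅ i′ ⁆ ⊎ l ∈ˢ ⁅ i ⁆ → l ∉ˢ Q
    ∉Q l∈pair l∈Q = x∈p⇒x∉∁p (x∈p∪q⁺ l∈pair) (Q⊆∁pair l∈Q)
    dimension : ∣ ∁ (Q ∪ ⁅ i ⁆) ∣ ≡ m ∸ k ∸ 1
    dimension = begin
      ∣ ∁ (Q ∪ ⁅ i ⁆) ∣   ≡⟨ ∣∁p∣≡n∸∣p∣ (Q ∪ ⁅ i ⁆) ⟩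
      m ∸ ∣ Q ∪ ⁅ i ⁆ ∣   ≡⟨ cong (m ∸_) (∣p∪⁅x⁆∣≡1+∣p∣ Q (∉Q (inj₂ (x∈⁅x⁆ i)))) ⟩
      m ∸ suc ∣ Q ∣       ≡⟨ cong (λ j → m ∸ suc j) (trans ∣Q∣≡k′ (rank-unique A rank′ rank)) ⟩
      m ∸ suc k           ≡⟨ m∸[1+n]≡m∸n∸1 m k ⟩
      m ∸ k ∸ 1           ∎
      where open ≡-Reasoning

  length-allFin : ∀ m → length (allFin m) ≡ m
  length-allFin m = length-tabulate {n = m} id

  ¬all⇒∃¬ : ∀ {X : Set} (p : X → Bool) xs → ¬ T (all p xs) → ∃ λ x → x ∈ᴸ xs × ¬ T (p x)
  ¬all⇒∃¬ p xs ¬all = find (¬All⇒Any¬ (T? ∘ p) xs (¬all ∘ all⁻ p))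

  nondistinct⇒coincide : ∀ {m} (x : Fin m → ℕ) → ¬ T (distinctᵇ x) → ∃ λ i → ∃ λ i′ → T (coincideᵇ i i′ x)
  nondistinct⇒coincide {m} x nondistinct with ¬all⇒∃¬ _ (allFin m) nondistinct
  ... | i , _ , ¬all with ¬all⇒∃¬ _ (allFin m) ¬all
  ... | i′ , _ , ¬distinct = i , i′ , coincide (does (i ≟ i′)) (x i ≡ᵇ x i′) ¬distinct
    where
    coincide : ∀ d q → ¬ T (d ∨ not q) → T (not d ∧ q)
    coincide false true  _ = _
    coincide true  _     ¬t = ⊥-elim (¬t _)
    coincide false false ¬t = ⊥-elim (¬t _)

  count-nondistinct≤ : ∀ {r m} (A : Matrix r m) b k → Abundant A → Rank A k → ∀ n
    → count (λ x → solᵇ A b x ∧ not (distinctᵇ x)) (tuples m n) ≤ m * (m * n ^ (m ∸ k ∸ 1))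
  count-nondistinct≤ {m = m} A b k abundant rank n = begin
    count (λ x → solᵇ A b x ∧ not (distinctᵇ x)) (tuples m n)
      ≤⟨ count-cover _ (λ i x → solᵇ A b x ∧ any (λ i′ → coincideᵇ i i′ x) (allFin m)) (tuples m n) (allFin m) some-row ⟩
    sumBy (λ i → count (λ x → solᵇ A b x ∧ any (λ i′ → coincideᵇ i i′ x) (allFin m)) (tuples m n)) (allFin m)
      ≤⟨ sumBy-mono _ _ (allFin m) (λ {i} _ → row i) ⟩
    sumBy (λ _ → m * n ^ e) (allFin m)
      ≡⟨ trans (sumBy-const _ (allFin m)) (cong (_* (m * n ^ e)) (length-allFin m)) ⟩
    m * (m * n ^ e) ∎
    where
    open ≤-Reasoning
    e = m ∸ k ∸ 1
    split : ∀ {p q : Bool} → T (p ∧ q) → T p × T q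
    split {p} = Equivalence.to (T-∧ {p})
    some-row : ∀ {x} → x ∈ᴸ tuples m n → T (solᵇ A b x ∧ not (distinctᵇ x))
      → ∃ λ i → i ∈ᴸ allFin m × T (solᵇ A b x ∧ any (λ i′ → coincideᵇ i i′ x) (allFin m))
    some-row {x} _ p with split {solᵇ A b x} p
    ... | sol , nd with nondistinct⇒coincide x (λ d → subst T (Equivalence.to T-not-≡ nd) d)
    ...   | i , i′ , c = i , ∈-allFin i , Equivalence.from T-∧ (sol , any⁺ _ (lose (∈-allFin i′) c))
    pairBound : ∀ i i′ → Dec (i ≡ i′) → count (λ x → solᵇ A b x ∧ coincideᵇ i i′ x) (tuples m n) ≤ n ^ e
    pairBound i i′ (no i≢i′) = count-coincident≤ A b k abundant rank n i≢i′
    pairBound i .i (yes refl) = ≤-trans (≤-reflexive (count-zero _ (tuples m n) never)) z≤n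
      where
      never : ∀ {x} → x ∈ᴸ tuples m n → ¬ T (solᵇ A b x ∧ coincideᵇ i i x)
      never {x} _ p with split {not (does (i ≟ i))} (proj₂ (split {solᵇ A b x} p))
      ... | i≢i , _ = subst T (Equivalence.to T-not-≡ i≢i) (Equivalence.from T-≡ (dec-true (i ≟ i) refl))
    row : ∀ i → count (λ x → solᵇ A b x ∧ any (λ i′ → coincideᵇ i i′ x) (allFin m)) (tuples m n) ≤ m * n ^ e
    row i = begin
      count (λ x → solᵇ A b x ∧ any (λ i′ → coincideᵇ i i′ x) (allFin m)) (tuples m n)
        ≤⟨ count-cover _ (λ i′ x → solᵇ A b x ∧ coincideᵇ i i′ x) (tuples m n) (allFin m) some-column ⟩
      sumBy (λ i′ → count (λ x → solᵇ A b x ∧ coincideᵇ i i′ x) (tuples m n)) (allFin m)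
        ≤⟨ sumBy-mono _ _ (allFin m) (λ {i′} _ → pairBound i i′ (i ≟ i′)) ⟩
      sumBy (λ _ → n ^ e) (allFin m)
        ≡⟨ trans (sumBy-const _ (allFin m)) (cong (_* n ^ e) (length-allFin m)) ⟩
      m * n ^ e ∎
      where
      some-column : ∀ {x} → x ∈ᴸ tuples m n → T (solᵇ A b x ∧ any (λ i′ → coincideᵇ i i′ x) (allFin m))
        → ∃ λ i′ → i′ ∈ᴸ allFin m × T (solᵇ A b x ∧ coincideᵇ i i′ x)
      some-column {x} _ p with split {solᵇ A b x} p
      ... | sol , c with find (any⁻ _ (allFin m) c)
      ...   | i′ , i′∈ , c′ = i′ , i′∈ , Equivalence.from T-∧ (sol , c′)

  edgeOf-fibre : ∀ {m} n (x x₀ : Fin m → ℕ) → InRange n x → edgeOf n x ≡ edgeOf n x₀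
    → ∀ l → T (inImage x₀ (allFin m) (x l))
  edgeOf-fibre {m} n x x₀ x-range same-edge l with x l in xl | ∈-range⁻ (x-range l)
  ... | suc t | _ , t<n = any⁺ _ (lose (∈-allFin j) (subst (λ a → T (a ≡ᵇ x₀ j)) (cong suc (toℕ-fromℕ< t<n)) v∈x₀))
    where
    v : Fin n
    v = fromℕ< t<n
    v∈x : T (Vec.lookup (edgeOf n x) v)
    v∈x = subst T (sym (lookup∘tabulate _ v))
            (any⁺ _ (lose (∈-allFin l) (subst (λ a → T (suc (toℕ v) ≡ᵇ a)) (sym xl)
                                         (≡⇒≡ᵇ _ _ (cong suc (toℕ-fromℕ< t<n))))))
    v∈x₀-any : T (any (λ j → suc (toℕ v) ≡ᵇ x₀ j) (allFin m))
    v∈x₀-any = subst T (lookup∘tabulate _ v) (subst (λ e → T (Vec.lookup e v)) same-edge v∈x)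
    j = proj₁ (find (any⁻ _ (allFin m) v∈x₀-any))
    v∈x₀ : T (suc (toℕ v) ≡ᵇ x₀ j)
    v∈x₀ = proj₂ (proj₂ (find (any⁻ _ (allFin m) v∈x₀-any)))

  numEdges≤count-solutions : ∀ {r m} (A : Matrix r m) b n → numEdges A b n ≤ count (solᵇ A b) (tuples m n)
  numEdges≤count-solutions {m = m} A b n = begin
    numEdges A b n
      ≤⟨ length-deduplicate (≡-dec _≟B_) (List.map (edgeOf n) S) ⟩
    length (List.map (edgeOf n) S)
      ≡⟨ length-map (edgeOf n) S ⟩
    length S
      ≡⟨ length-filterᵇ _ (tuples m n) ⟩
    count (λ x → solᵇ A b x ∧ distinctᵇ x) (tuples m n)
      ≤⟨ count-∧≤ (solᵇ A b) distinctᵇ (tuples m n) ⟩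
    count (solᵇ A b) (tuples m n)                              ∎
    where
    open ≤-Reasoning
    S = filterᵇ (λ x → solᵇ A b x ∧ distinctᵇ x) (tuples m n)

  count-distinctSolutions≤ : ∀ {r m} (A : Matrix r m) b n
    → count (λ x → solᵇ A b x ∧ distinctᵇ x) (tuples m n) ≤ numEdges A b n * m ^ m
  count-distinctSolutions≤ {m = m} A b n = begin
    count P (tuples m n)
      ≡⟨ length-filterᵇ P (tuples m n) ⟨
    length S
      ≡⟨ count-true S ⟨
    count (λ _ → true) S
      ≤⟨ count-cover _ sameEdge S E (λ {x} x∈S _ → edgeOf n x , edge∈E x∈S , sameEdge-refl x) ⟩
    sumBy (λ e → count (sameEdge e) S) E
      ≤⟨ sumBy-mono _ _ E fibre≤ ⟩
    sumBy (λ _ → m ^ m) E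
      ≡⟨ sumBy-const _ E ⟩
    length E * m ^ m                    ∎
    where
    open ≤-Reasoning
    P = λ x → solᵇ A b x ∧ distinctᵇ x
    S = filterᵇ P (tuples m n)
    E = edges A b n
    sameEdge : Subset n → (Fin m → ℕ) → Bool
    sameEdge e x = does (≡-dec _≟B_ (edgeOf n x) e)
    sameEdge-refl : ∀ x → T (sameEdge (edgeOf n x) x)
    sameEdge-refl x = T-does⁺ (≡-dec _≟B_ (edgeOf n x) (edgeOf n x)) refl
    edge∈E : ∀ {x} → x ∈ᴸ S → edgeOf n x ∈ᴸ E
    edge∈E x∈S = ∈-deduplicate⁺ (≡-dec _≟B_) (∈-map⁺ (edgeOf n) x∈S)
    fibre≤ : ∀ {e} → e ∈ᴸ E → count (sameEdge e) S ≤ m ^ m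
    fibre≤ e∈E with ∈-map⁻ (edgeOf n) (∈-deduplicate⁻ (≡-dec _≟B_) _ e∈E)
    ... | x₀ , _ , refl = begin
      count (sameEdge (edgeOf n x₀)) S            ≤⟨ count-mono _ W S (λ x∈S same → allEntries⁺ _ _
                                                        (edgeOf-fibre n _ x₀ (∈-tuples⁻ m n (proj₁ (∈-filter⁻ (T? ∘ P) x∈S)))
                                                                      (T-does⁻ (≡-dec _≟B_ _ _) same))) ⟩
      count W S
        ≤⟨ count-filterᵇ≤ P W (tuples m n) ⟩
      count W (tuples m n)
        ≡⟨ count-tuples-allEntries m n _ ⟩
      count (inImage x₀ (allFin m)) (range n) ^ m
        ≤⟨ ^-monoˡ-≤ m (count-inImage≤length x₀ (allFin m) (range n) (range-unique n)) ⟩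
      length (allFin m) ^ m
        ≡⟨ cong (_^ m) (length-allFin m) ⟩
      m ^ m                                       ∎
      where W = allEntries (inImage x₀ (allFin m))

  +∣z∣≡z : ∀ {z X} → z ≡ + X → + ℤ.∣ z ∣ ≡ z
  +∣z∣≡z refl = refl

  module Windows {r m} (A : Matrix r m) b Q (Q-max : MaximalIndependent A Q)
                 (y : Fin m → ℤ) (y-pos : ∀ j → + 0 ℤ.< y j) (y∈ker : InKernel A y)
                 (x₀ : Fin m → ℤ) (x₀-sol : IsSolution A b x₀) (n L : ℕ) where

    open Family A b Q Q-max y y-pos y∈ker x₀ x₀-sol

    value : Fin m → ℕ → ℕ
    value l a = ℤ.∣ φ (shift L) l a ∣

    window : Fin m → ℕ → Bool
    window l = inImage (value l) (upTo L)

    value-φ : ∀ l → l ∉ˢ Q → ∀ {a} → a ≤ L → + value l a ≡ φ (shift L) l a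
    value-φ l l∉Q a≤L = +∣z∣≡z (proj₁ (proj₂ (φ-range L l l∉Q _ a≤L)))

    value∈range : suc L * H ≤ n → ∀ l → l ∉ˢ Q → ∀ {a} → a ≤ L → value l a ∈ᴸ range n
    value∈range fits l l∉Q a≤L with φ-range L l l∉Q _ a≤L
    ... | X , φ≡X , 1≤X , X≤ rewrite φ≡X = ∈-range⁺ 1≤X (≤-trans X≤ fits)

    windows-wide : suc L * H ≤ n → ∀ l → l ∉ˢ Q → L ≤ count (window l) (range n)
    windows-wide fits l l∉Q = subst (_≤ count (window l) (range n)) (length-upTo L)
      (length≤count-inImage (value l) (upTo L) (range n) (upTo⁺ L) value-injective
        (λ a∈ → value∈range fits l l∉Q (<⇒≤ (∈-upTo⁻ a∈))))
      where
      value-injective : ∀ {a a′} → a ∈ᴸ upTo L → a′ ∈ᴸ upTo L → value l a ≡ value l a′ → a ≡ a′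
      value-injective {a} {a′} a∈ a′∈ same = φ-injective (shift L) l l∉Q (begin
        φ (shift L) l a   ≡⟨ value-φ l l∉Q (<⇒≤ (∈-upTo⁻ a∈)) ⟨
        + value l a       ≡⟨ cong +_ same ⟩
        + value l a′      ≡⟨ value-φ l l∉Q (<⇒≤ (∈-upTo⁻ a′∈)) ⟩
        φ (shift L) l a′  ∎)
        where open ≡-Reasoning

    windows-extendable : suc L * H ≤ n → Extendable n Q window (solᵇ A b)
    windows-extendable fits x x-window = x′ , x′∈range , IsSolution⇒solᵇ A b x′ x′-sol , agree
      where
      choice : ∀ l → Dec (l ∈ˢ Q) → ∃ λ a → a ≤ L × (l ∉ˢ Q → x l ≡ value l a)
      choice l (yes l∈Q) = 0 , z≤n , λ l∉Q → ⊥-elim (l∉Q l∈Q)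
      choice l (no l∉Q) with find (any⁻ _ (upTo L) (x-window l l∉Q))
      ... | a , a∈ , xl≡ = a , <⇒≤ (∈-upTo⁻ a∈) , λ _ → ≡ᵇ⇒≡ _ _ xl≡
      s : Fin m → ℕ
      s l = proj₁ (choice l (l ∈? Q))
      s≤L : ∀ l → s l ≤ L
      s≤L l = proj₁ (proj₂ (choice l (l ∈? Q)))
      x′ : Fin m → ℕ
      x′ i = ℤ.∣ ψ (shift L) s i ∣
      x′≡ψ : ∀ i → + x′ i ≡ ψ (shift L) s i
      x′≡ψ i = +∣z∣≡z (proj₁ (proj₂ (ψ-range L s s≤L i)))
      x′∈range : InRange n x′
      x′∈range i with ψ-range L s s≤L i
      ... | X , ψ≡X , 1≤X , X≤ rewrite ψ≡X = ∈-range⁺ 1≤X (≤-trans X≤ fits)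
      x′-sol : IsSolutionℕ A b x′
      x′-sol i = trans (dot-congʳ (A i) x′≡ψ) (ψ-sol (shift L) s i)
      agree : AgreeOutside Q x′ x
      agree l l∉Q = trans (cong ℤ.∣_∣ (ψ-diagonal (shift L) s l l∉Q)) (sym (proj₂ (proj₂ (choice l (l ∈? Q))) l∉Q))

  count-solutions≥ : ∀ {r m} (A : Matrix r m) b → Positive A → (∃ λ x → IsSolution A b x) → ∀ k → Rank A k
    → ∃ λ H → ∀ n L → suc L * H ≤ n → L ^ (m ∸ k) ≤ count (solᵇ A b) (tuples m n)
  count-solutions≥ {m = m} A b (y , y-pos , y∈ker) (x₀ , x₀-sol) k rank with rank⇒maximalIndependent A k rank
  ... | Q , ∣Q∣≡k , Q-max = H , bound
    where
    open Family A b Q Q-max y y-pos y∈ker x₀ x₀-sol using (H)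
    bound : ∀ n L → suc L * H ≤ n → L ^ (m ∸ k) ≤ count (solᵇ A b) (tuples m n)
    bound n L fits =
      subst (_≤ count (solᵇ A b) (tuples m n)) (cong (L ^_) (trans (∣∁p∣≡n∸∣p∣ Q) (cong (m ∸_) ∣Q∣≡k)))
            (count-tuples≥ m n L Q (solᵇ A b) window (solᵇ-resp A b) (windows-wide fits) (windows-extendable fits))
      where open Windows A b Q Q-max y y-pos y∈ker x₀ x₀-sol n L

  ∸-suc-pred : ∀ {m k} → k < m → m ∸ k ≡ suc (m ∸ k ∸ 1)
  ∸-suc-pred {m} {k} k<m = trans (sym (m∸n+n≡m (m<n⇒0<n∸m k<m))) (+-comm (m ∸ k ∸ 1) 1)

  ^-distribʳ-* : ∀ a b e → (a * b) ^ e ≡ a ^ e * b ^ e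
  ^-distribʳ-* a b zero    = refl
  ^-distribʳ-* a b (suc e) = trans (cong (a * b *_) (^-distribʳ-* a b e)) (interchange a b (a ^ e) (b ^ e))
    where
    interchange : ∀ a b x y → a * b * (x * y) ≡ a * x * (b * y)
    interchange = ℕ-Solver.solve-∀

  scale : ∀ c n → 2 * suc c ≤ n → ∃ λ L → suc L * suc c ≤ n × n ≤ 4 * suc c * L
  scale c n 2c≤n = L , fits , covers
    where
    d = 2 * suc c
    L = n / d
    1≤L : 1 ≤ L
    1≤L = m≥n⇒m/n>0 2c≤n
    dL≤n : d * L ≤ n
    dL≤n = ≤-trans (≤-reflexive (*-comm d L)) (m/n*n≤m n d)
    n<d[1+L] : n < d * suc L
    n<d[1+L] = begin-strict
      n                ≡⟨ m≡m%n+[m/n]*n n d ⟩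
      n % d + L * d    <⟨ +-monoˡ-< (L * d) (m%n<n n d) ⟩
      d + L * d        ≡⟨ cong (_+_ d) (*-comm L d) ⟩
      d + d * L        ≡⟨ *-suc d L ⟨
      d * suc L        ∎
      where open ≤-Reasoning
    fits : suc L * suc c ≤ n
    fits = ≤-trans (*-monoˡ-≤ (suc c) (+-monoˡ-≤ L 1≤L)) (≤-trans (≤-reflexive (double L (suc c))) dL≤n)
      where
      double : ∀ L c → (L + L) * c ≡ 2 * c * L
      double = ℕ-Solver.solve-∀
    covers : n ≤ 4 * suc c * L
    covers = ≤-trans (<⇒≤ n<d[1+L]) (≤-trans (*-monoʳ-≤ d (+-monoˡ-≤ L 1≤L)) (≤-reflexive (double L (suc c))))
      where
      double : ∀ L c → 2 * c * (L + L) ≡ 4 * c * L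
      double = ℕ-Solver.solve-∀

  absorb : ∀ X Z W → X ≤ Z + W → 2 * W ≤ X → X ≤ 2 * Z
  absorb X Z W X≤Z+W 2W≤X = +-cancelˡ-≤ X X (2 * Z) (begin
    X + X               ≡⟨ cong (_+_ X) (sym (+-identityʳ X)) ⟩
    2 * X               ≤⟨ *-monoʳ-≤ 2 X≤Z+W ⟩
    2 * (Z + W)         ≡⟨ twice Z W ⟩
    2 * W + 2 * Z       ≤⟨ +-monoˡ-≤ (2 * Z) 2W≤X ⟩
    X + 2 * Z           ∎)
    where
    open ≤-Reasoning
    twice : ∀ Z W → 2 * (Z + W) ≡ 2 * W + 2 * Z
    twice = ℕ-Solver.solve-∀

  count-solutions≤edges : ∀ {r m} (A : Matrix r m) b k → Abundant A → Rank A k → ∀ n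
    → count (solᵇ A b) (tuples m n) ≤ numEdges A b n * m ^ m + m * (m * n ^ (m ∸ k ∸ 1))
  count-solutions≤edges {m = m} A b k abundant rank n = begin
    count (solᵇ A b) (tuples m n)
      ≡⟨ count-split (solᵇ A b) distinctᵇ (tuples m n) ⟩
    count (λ x → solᵇ A b x ∧ distinctᵇ x) (tuples m n) + count (λ x → solᵇ A b x ∧ not (distinctᵇ x)) (tuples m n)
      ≤⟨ +-mono-≤ (count-distinctSolutions≤ A b n) (count-nondistinct≤ A b k abundant rank n) ⟩
    numEdges A b n * m ^ m + m * (m * n ^ (m ∸ k ∸ 1)) ∎
    where open ≤-Reasoning

  numEdges≤ : ∀ {r m} (A : Matrix r m) b k → Rank A k → k < m → ∀ n → numEdges A b n ≤ n ^ (m ∸ k ∸ 1) * n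
  numEdges≤ {m = m} A b k rank k<m n with rank⇒maximalIndependent A k rank
  ... | Q , ∣Q∣≡k , indep , _ = begin
    numEdges A b n                   ≤⟨ numEdges≤count-solutions A b n ⟩
    count (solᵇ A b) (tuples m n)    ≤⟨ count-solutions≤ A b n Q indep ⟩
    n ^ (m ∸ ∣ Q ∣)                  ≡⟨ cong (λ j → n ^ (m ∸ j)) ∣Q∣≡k ⟩
    n ^ (m ∸ k)                      ≡⟨ cong (n ^_) (∸-suc-pred k<m) ⟩
    n * n ^ (m ∸ k ∸ 1)              ≡⟨ *-comm n _ ⟩
    n ^ (m ∸ k ∸ 1) * n              ∎
    where open ≤-Reasoning

  polynomial-lower : ∀ n L c E M R e → n ≤ c * L → L ^ suc e ≤ E * M + R → 2 * (c ^ suc e * R) ≤ n ^ suc e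
    → n ^ suc e ≤ E * (2 * (c ^ suc e * M))
  polynomial-lower n L c E M R e n≤cL Lᵈ≤ small = begin
    n ^ suc e                            ≤⟨ absorb (n ^ suc e) (c ^ suc e * (E * M)) (c ^ suc e * R) split small ⟩
    2 * (c ^ suc e * (E * M))            ≡⟨ rearrange 2 (c ^ suc e) E M ⟩
    E * (2 * (c ^ suc e * M))            ∎
    where
    open ≤-Reasoning
    rearrange : ∀ a b c d → a * (b * (c * d)) ≡ c * (a * (b * d))
    rearrange = ℕ-Solver.solve-∀
    split : n ^ suc e ≤ c ^ suc e * (E * M) + c ^ suc e * R
    split = begin
      n ^ suc e                         ≤⟨ ^-monoˡ-≤ (suc e) n≤cL ⟩
      (c * L) ^ suc e                   ≡⟨ ^-distribʳ-* c L (suc e) ⟩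
      c ^ suc e * L ^ suc e             ≤⟨ *-monoʳ-≤ (c ^ suc e) Lᵈ≤ ⟩
      c ^ suc e * (E * M + R)           ≡⟨ *-distribˡ-+ (c ^ suc e) (E * M) R ⟩
      c ^ suc e * (E * M) + c ^ suc e * R ∎

  ≤numEdges : ∀ {r m} (A : Matrix r m) b → Positive A → Abundant A → (∃ λ x → IsSolution A b x)
    → ∀ k → Rank A k → k < m
    → ∃ λ D → ∃ λ n₀ → ∀ n → n₀ ≤ n → n ^ (m ∸ k ∸ 1) * n ≤ numEdges A b n * suc D
  ≤numEdges {m = m} A b positive abundant solvable k rank k<m with count-solutions≥ A b positive solvable k rank
  ... | H , enough = 2 * (K ^ suc e * m ^ m) , 2 * suc H + R₀ , lower
    where
    e = m ∸ k ∸ 1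
    K = 4 * suc H
    R₀ = 2 * (K ^ suc e * (m * m))
    lower : ∀ n → 2 * suc H + R₀ ≤ n → n ^ e * n ≤ numEdges A b n * suc (2 * (K ^ suc e * m ^ m))
    lower n n₀≤n = let L , fits , covers = scale H n (≤-trans (m≤m+n (2 * suc H) R₀) n₀≤n) in at-scale L fits covers
      where
      open ≤-Reasoning
      E = numEdges A b n
      small : 2 * (K ^ suc e * (m * (m * n ^ e))) ≤ n ^ suc e
      small = begin
        2 * (K ^ suc e * (m * (m * n ^ e)))   ≡⟨ regroup 2 (K ^ suc e) m (n ^ e) ⟩
        R₀ * n ^ e                            ≤⟨ *-monoˡ-≤ (n ^ e) (≤-trans (m≤n+m R₀ (2 * suc H)) n₀≤n) ⟩
        n * n ^ e                             ∎
        where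
        regroup : ∀ a b m x → a * (b * (m * (m * x))) ≡ a * (b * (m * m)) * x
        regroup = ℕ-Solver.solve-∀
      at-scale : ∀ L → suc L * suc H ≤ n → n ≤ K * L → n ^ e * n ≤ E * suc (2 * (K ^ suc e * m ^ m))
      at-scale L fits covers = begin
        n ^ e * n                          ≡⟨ *-comm (n ^ e) n ⟩
        n ^ suc e                          ≤⟨ polynomial-lower n L K E (m ^ m) (m * (m * n ^ e)) e covers Lᵈ≤ small ⟩
        E * (2 * (K ^ suc e * m ^ m))      ≤⟨ *-monoʳ-≤ E (n≤1+n (2 * (K ^ suc e * m ^ m))) ⟩
        E * suc (2 * (K ^ suc e * m ^ m))  ∎
        where
        Lᵈ≤ : L ^ suc e ≤ E * m ^ m + m * (m * n ^ e)
        Lᵈ≤ = ≤-trans (≤-reflexive (cong (L ^_) (sym (∸-suc-pred k<m))))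
                (≤-trans (enough n L (≤-trans (*-monoʳ-≤ (suc L) (n≤1+n H)) fits))
                         (count-solutions≤edges A b k abundant rank n))

  abundant⇒0<rank : ∀ {r m} (A : Matrix r m) k → Abundant A → Rank A k → 0 < k
  abundant⇒0<rank A k (k′ , rank′ , 0<k′ , _) rank = subst (0 <_) (rank-unique A rank′ rank) 0<k′

  numEdges-Θ : ∀ {r m} (A : Matrix r m) b → Positive A → Abundant A → (∃ λ x → IsSolution A b x) → ∀ k → Rank A k
    → ∃ λ D → ∃ λ n₀ → ∀ n → n₀ ≤ n
      → numEdges A b (suc n) ≤ suc n ^ (m ∸ k ∸ 1) * suc n × suc n ^ (m ∸ k ∸ 1) * suc n ≤ numEdges A b (suc n) * suc D
  numEdges-Θ A b positive abundant solvable k rank =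
    let D , n₀ , lower = ≤numEdges A b positive abundant solvable k rank k<m in
    D , n₀ , λ n n₀≤n → numEdges≤ A b k rank k<m (suc n) , lower (suc n) (m≤n⇒m≤1+n n₀≤n)
    where k<m = positive⇒rank<m A k positive (abundant⇒0<rank A k abundant rank) rank

module Density where

  open import Data.Integer as ℤ using (+_)
  import Data.Integer.Properties as ℤ
  open import Data.Nat using (_*_; _≤_)
  import Data.Nat.Properties as ℕ
  open import Data.Rational using (ℚ; 0ℚ; _/_; toℚᵘ) renaming (_*_ to _*ℚ_; _≤_ to _≤ℚ_; _<_ to _<ℚ_)
  import Data.Rational.Properties as ℚ
  import Data.Rational.Unnormalised as ℚᵘ
  import Data.Rational.Unnormalised.Properties as ℚᵘ

  1/[1+_] : ℕ → ℚ
  1/[1+ D ] = + 1 / suc D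

  1/[1+]-positive : ∀ D → 0ℚ <ℚ 1/[1+ D ]
  1/[1+]-positive D = ℚ.positive⁻¹ 1/[1+ D ] ⦃ ℚ.normalize-pos 1 (suc D) ⦄

  toℚᵘ-/ : ∀ p q → toℚᵘ (p / suc q) ℚᵘ.≃ ℚᵘ.mkℚᵘ p q
  toℚᵘ-/ p q = ℚ.toℚᵘ-fromℚᵘ (ℚᵘ.mkℚᵘ p q)

  toℚᵘ-scaled : ∀ D a → toℚᵘ (1/[1+ D ] *ℚ ℕtoℚ a) ℚᵘ.≃ ℚᵘ.mkℚᵘ (+ 1) D ℚᵘ.* ℚᵘ.mkℚᵘ (+ a) 0
  toℚᵘ-scaled D a = ℚᵘ.≃-trans (ℚ.toℚᵘ-homo-* 1/[1+ D ] (ℕtoℚ a)) (ℚᵘ.*-cong (toℚᵘ-/ (+ 1) D) (toℚᵘ-/ (+ a) 0))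

  +[a*b]≡[1*a]*b : ∀ a b → + (a * b) ≡ (+ 1 ℤ.* + a) ℤ.* + b
  +[a*b]≡[1*a]*b a b = trans (ℤ.pos-* a b) (cong (ℤ._* + b) (sym (ℤ.*-identityˡ (+ a))))

  ratio-≥ : ∀ E a D n → a * suc n ≤ E * suc D → 1/[1+ D ] *ℚ ℕtoℚ a ≤ℚ ratio E (suc n)
  ratio-≥ E a D n a[1+n]≤E[1+D] = ℚ.toℚᵘ-cancel-≤
    (ℚᵘ.≤-respˡ-≃ (ℚᵘ.≃-sym (toℚᵘ-scaled D a)) (ℚᵘ.≤-respʳ-≃ (ℚᵘ.≃-sym (toℚᵘ-/ (+ E) n)) (ℚᵘ.*≤* cross)))
    where
    cross : (+ 1 ℤ.* + a) ℤ.* + suc n ℤ.≤ + E ℤ.* + suc (D * 1)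
    cross = subst₂ ℤ._≤_ (+[a*b]≡[1*a]*b a (suc n))
                         (trans (ℤ.pos-* E (suc D)) (cong (λ d → + E ℤ.* + suc d) (sym (ℕ.*-identityʳ D))))
                         (ℤ.+≤+ a[1+n]≤E[1+D])

  ratio-≤ : ∀ E a n → E ≤ a * suc n → ratio E (suc n) ≤ℚ 1/[1+ 0 ] *ℚ ℕtoℚ a
  ratio-≤ E a n E≤a[1+n] = ℚ.toℚᵘ-cancel-≤
    (ℚᵘ.≤-respʳ-≃ (ℚᵘ.≃-sym (toℚᵘ-scaled 0 a)) (ℚᵘ.≤-respˡ-≃ (ℚᵘ.≃-sym (toℚᵘ-/ (+ E) n)) (ℚᵘ.*≤* cross)))
    where
    cross : + E ℤ.* + 1 ℤ.≤ (+ 1 ℤ.* + a) ℤ.* + suc n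
    cross = subst₂ ℤ._≤_ (sym (ℤ.*-identityʳ (+ E))) (+[a*b]≡[1*a]*b a (suc n)) (ℤ.+≤+ E≤a[1+n])

open Solutions using (numEdges-Θ)
open Density using (1/[1+_]; 1/[1+]-positive; ratio-≥; ratio-≤)

open import Data.Nat using (ℕ; _∸_; _^_; _≤_; s≤s)
open import Data.Integer using (ℤ)
open import Data.Fin using (Fin)
open import Data.Rational using (ℚ; 0ℚ; _*_) renaming (_≤_ to _≤ℚ_; _<_ to _<ℚ_)
open import Data.Product using (∃; _×_)

lemma4p5 : ∀ {r m} (A : Matrix r m) (b : Fin r → ℤ)
    → Positive A → Abundant A → (∃ λ x → IsSolution A b x)
    → ∀ (k : ℕ) → Rank A k
    → ∃ λ (c₁ : ℚ) → ∃ λ (c₂ : ℚ) → ∃ λ (n₀ : ℕ)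
        → 0ℚ <ℚ c₁ × 0ℚ <ℚ c₂
        × (∀ n → n₀ ≤ n
             → (c₁ * ℕtoℚ (n ^ (m ∸ k ∸ 1)) ≤ℚ density A b n)
             × (density A b n ≤ℚ c₂ * ℕtoℚ (n ^ (m ∸ k ∸ 1))))
lemma4p5 {m = m} A b positive abundant solvable k rank =
  let D , n₀ , Θ = numEdges-Θ A b positive abundant solvable k rank in
  1/[1+ D ] , 1/[1+ 0 ] , suc n₀ , 1/[1+]-positive D , 1/[1+]-positive 0 ,
  λ { (suc n) (s≤s n₀≤n) → let E = numEdges A b (suc n) ; a = suc n ^ (m ∸ k ∸ 1) in
                           ratio-≥ E a D n (proj₂ (Θ n n₀≤n)) , ratio-≤ E a n (proj₁ (Θ n n₀≤n)) }
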